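{- Let $n\ge 2$ and $E_n(x,q)=\sum_{\pi\in S_n}x^{\mathrm{des}(\pi)}q^{w(\pi)}$. Then the coefficient of $x$ in $E_n(x,q)$ is \[ \sum_{j=0}^{n-2}(2^{j+1}-1)\,q^{n-2-j}=q^{n-2}+3q^{n-3}+7q^{n-4}+\dots+(2^{n-1}-1), \] and the coefficient of $x^{n-2}$ in $E_n(x,q)$ is \[ \sum_{j=0}^{n-2}\binom{n}{j}q^{n-2-j}=q^{n-2}+\binom n1 q^{n-3}+\binom n2 q^{n-4}+\dots+\binom{n}{n-2}. \]
   Context: For a word $\sigma$ of distinct positive integers, $\mathrm{des}(\sigma)$ is its number of descents (adjacent positions $i$ with $\sigma_i>\sigma_{i+1}$) and $\mathrm{st}(\sigma)$ is its standardization (replace the $j$-th smallest letter by $j$), a permutation. The weight $w\colon S_n\to\mathbb Z_{\ge0}$ is defined recursively: if $\pi$ is the identity $12\cdots n$ or the decreasing permutation $n(n-1)\cdots1$, then $w(\pi)=0$. Otherwise form the word $\pi(1)\cdots\pi(n)(n+1)$ and write it as $\pi_L\cdot 1\cdot\pi_R$, where $\pi_L$ is the (possibly empty) subword left of the letter $1$ and $\pi_R$ the subword right of $1$ (ending in $n+1$). Decompose $\pi_L=\pi_1\cdots\pi_l$: $\pi_1$ is the prefix of $\pi_L$ ending at its largest letter, $\pi_2$ the prefix of the remaining word ending at its largest letter, and so on. Then $w(\pi)=w(\mathrm{st}(\pi_R))+\mathrm{des}(\pi_R)+\sum_{i=1}^{l}\bigl(w(\mathrm{st}(\pi_i))+\mathrm{des}(\pi_i)\bigr)$.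 -}

module Defs where

open import Data.Nat using (ℕ; zero; suc; _+_; _*_; _∸_; _^_; _<ᵇ_; _≡ᵇ_)
open import Data.Nat.Combinatorics using (_C_)
open import Data.Bool using (Bool; true; false; if_then_else_; _∧_; _∨_; not)
open import Data.List using (List; []; _∷_; _++_; map; length; concatMap; filter; upTo; reverse)
open import Data.Product using (_×_; _,_)
open import Relation.Nullary.Decidable using (⌊_⌋; _×-dec_)
open import Data.Nat.ListAction using (sum)
open import Relation.Binary.PropositionalEquality using (_≡_)

-- Words of distinct positive integers are represented as lists of ℕ;
-- permutations of [n] are lists containing 1,…,n once each (one-line notation).

_==ₗ_ : List ℕ → List ℕ → Bool
[] ==ₗ [] = true
(x ∷ xs) ==ₗ (y ∷ ys) = (x ≡ᵇ y) ∧ (xs ==ₗ ys)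
_ ==ₗ _ = false

des : List ℕ → ℕ
des [] = 0
des (x ∷ []) = 0
des (x ∷ y ∷ ys) = (if y <ᵇ x then 1 else 0) + des (y ∷ ys)

countLess : ℕ → List ℕ → ℕ
countLess x [] = 0
countLess x (y ∷ ys) = (if y <ᵇ x then 1 else 0) + countLess x ys

st : List ℕ → List ℕ
st l = map (λ x → suc (countLess x l)) l

idPerm : ℕ → List ℕ
idPerm n = map suc (upTo n)

decPerm : ℕ → List ℕ
decPerm n = reverse (idPerm n)

maxL : List ℕ → ℕ
maxL [] = 0
maxL (x ∷ xs) = Data.Nat._⊔_ x (maxL xs)

splitAt : ℕ → List ℕ → List ℕ × List ℕ
splitAt m [] = [] , []
splitAt m (x ∷ xs) with x ≡ᵇ m
... | true = [] , xs
... | false with splitAt m xs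
...   | (a , b) = (x ∷ a) , b

prefixToMax : List ℕ → List ℕ × List ℕ
prefixToMax l with splitAt (maxL l) l
... | (a , b) = (a ++ (maxL l ∷ [])) , b

-- decomposition π_L = π_1 ⋯ π_l  (fuel = length of the word suffices,
-- since each step removes at least one letter)
piecesF : ℕ → List ℕ → List (List ℕ)
piecesF zero _ = []
piecesF (suc f) [] = []
piecesF (suc f) (x ∷ xs) with prefixToMax (x ∷ xs)
... | (p , r) = p ∷ piecesF f r

pieces : List ℕ → List (List ℕ)
pieces l = piecesF (length l) l

-- The fuel (suc (n * n)) used
-- below for a permutation of length n is more than the recursion depth
--, so wF agrees with the recursive definition of the paper.
wF : ℕ → List ℕ → ℕ
wF zero π = 0
wF (suc f) π =
  if (π ==ₗ idPerm (length π)) ∨ (π ==ₗ decPerm (length π)) then 0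
  else go (splitAt 1 (π ++ (suc (length π) ∷ [])))
  where
  go : List ℕ × List ℕ → ℕ
  go (πL , πR) =
    wF f (st πR) + des πR
    + sum (map (λ p → wF f (st p) + des p) (pieces πL))

w : List ℕ → ℕ
w π = wF (suc (length π * length π)) π

insertions : ℕ → List ℕ → List (List ℕ)
insertions x [] = (x ∷ []) ∷ []
insertions x (y ∷ ys) = (x ∷ y ∷ ys) ∷ map (y ∷_) (insertions x ys)

perms : ℕ → List (List ℕ)
perms zero = [] ∷ []
perms (suc n) = concatMap (insertions (suc n)) (perms n)

coeffE : ℕ → ℕ → ℕ → ℕ
coeffE n k m = length (filter (λ π → Data.Nat._≟_ (des π) k ×-dec Data.Nat._≟_ (w π) m) (perms n))

coeffQ : ℕ → (ℕ → ℕ) → ℕ → ℕ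
coeffQ n c m = sum (map (λ j → if (n ∸ 2 ∸ j) ≡ᵇ m then c j else 0) (upTo (n ∸ 1)))

private
  open import Relation.Binary.PropositionalEquality using (refl)
  t1 : map (λ m → coeffE 4 1 m) (upTo 4) ≡ 7 ∷ 3 ∷ 1 ∷ 0 ∷ []
  t1 = refl
  t2 : map (λ m → coeffE 5 3 m) (upTo 5) ≡ 10 ∷ 10 ∷ 5 ∷ 1 ∷ 0 ∷ []
  t2 = refl
  t3 : map (λ m → coeffE 5 1 m) (upTo 5) ≡ 15 ∷ 7 ∷ 3 ∷ 1 ∷ 0 ∷ []
  t3 = refl
  t4 : length (perms 5) ≡ 120
  t4 = refl

-- The weight has a closed form on the two families involved.  Unfolding the recursion at the
-- letter 1 (the minimum) produces pieces that are increasing, or decreasing followed by their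
-- maximum, and these have weight 0; the only exception is a one-descent permutation starting
-- with 1, whose weight is one more than that of the rest followed by a new maximum.  Hence a
-- permutation with one descent has as weight the number of its leading letters lying below
-- everything to their right, and a permutation A B with one ascent (A, B decreasing) has
-- weight |B| - 1 when A ends below B, and #{a ∈ A : a < head B} - 1 otherwise.
--
-- These are counted by inserting n + 1 into the permutations of [n], which is how perms
-- enumerates S (n + 1).  Let D n m count the permutations of [n] with one descent and weight m.
-- A permutation with one descent has exactly two insertions keeping one descent and the weight,
-- and the identity contributes one permutation of each weight m < n; so
-- D (n + 1) m = [m < n] + 2 D n m, whence D n m = 2 ^ (n - 1 - m) - 1.  For one ascent only the
-- insertions in front, between the two runs, or (for decreasing σ) after the first letter keep
-- one ascent; following the type together with |B| resp. |A| - 1 along these insertions gives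
-- Pascal recurrences, solved by binomial coefficients.

module Submission where

open import Defs
open import Data.Bool using (Bool; T; _∧_; _∨_; false; if_then_else_; not; true)
open import Data.Bool.ListAction using (all)
open import Data.Bool.Properties using (∧-identityʳ; ∧-zeroʳ)
open import Data.Empty using (⊥-elim)
open import Data.List using (List; []; _++_; _∷_; _∷ʳ′_; applyUpTo; concatMap; filter; initLast; length; map; reverse; upTo)
open import Data.List.Membership.Propositional using (_∈_; _∉_)
open import Data.List.Membership.Propositional.Properties using (∈-++⁺ʳ; ∈-++⁺ˡ; ∈-++⁻; ∈-map⁻)
open import Data.List.Properties using (++-assoc; ++-identityʳ; length-++; length-map; length-upTo; map-++; map-applyUpTo; map-cong; map-cong-local; map-id-local; map-∘; reverse-++; upTo-∷ʳ)
open import Data.List.Relation.Binary.Subset.Propositional using (_⊆_)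
open import Data.List.Relation.Unary.All as All using (All; []; _∷_)
open import Data.List.Relation.Unary.All.Properties as All using (++⁺; ++⁻ʳ; ++⁻ˡ)
open import Data.List.Relation.Unary.AllPairs as AllPairs using ([]; _∷_)
open import Data.List.Relation.Unary.Any using (here; there)
open import Data.List.Relation.Unary.Linked as Linked using (Linked; [-]; []; _∷_)
open import Data.List.Relation.Unary.Linked.Properties using (Linked⇒All)
open import Data.List.Relation.Unary.Unique.Propositional using (Unique)
open import Data.Nat using (_*_; _+_; _<_; _<ᵇ_; _>_; _^_; _∸_; _≡ᵇ_; _≤_; _≤ᵇ_; suc; s≤s; zero; z≤n; ℕ)
open import Data.Nat.Combinatorics using (_C_; nC1≡n; nCk+nC[k+1]≡[n+1]C[k+1]; nCk≡nC[n∸k])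
open import Data.Nat.Combinatorics.Specification using (k>n⇒nCk≡0)
open import Data.Nat.ListAction using (sum)
open import Data.Nat.ListAction.Properties using (sum-++)
open import Data.Nat.Properties
open import Algebra.Properties.CommutativeSemigroup +-commutativeSemigroup using (interchange; x∙yz≈y∙xz)
open import Data.Product using (_,_; _×_; map₁; proj₁; proj₂; ∃-syntax)
open import Data.Sum using (_⊎_; inj₁; inj₂)
open import Data.Unit using (tt)
open import Function using (_∘_; flip)
open import Relation.Binary.Definitions using (Transitive; tri<; tri>; tri≈)
open import Relation.Binary.PropositionalEquality
open import Relation.Nullary using (does; no; yes)
open import Relation.Unary using (Decidable)

private variable
  m n x y : ℕ
  xs ys : List ℕ

χ : Bool → ℕ
χ b = if b then 1 else 0

χ≤1 : ∀ b → χ b ≤ 1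
χ≤1 true = ≤-refl
χ≤1 false = z≤n

<⇒<ᵇ≡true : ∀ {m n} → m < n → (m <ᵇ n) ≡ true
<⇒<ᵇ≡true {m} {n} m<n with m <ᵇ n | <⇒<ᵇ m<n
... | true | _ = refl

<ᵇ≡true⇒< : ∀ {m n} → (m <ᵇ n) ≡ true → m < n
<ᵇ≡true⇒< {m} {n} e = <ᵇ⇒< m n (subst T (sym e) tt)

≥⇒<ᵇ≡false : ∀ {m n} → n ≤ m → (m <ᵇ n) ≡ false
≥⇒<ᵇ≡false {m} {n} n≤m with m <ᵇ n in e
... | false = refl
... | true = ⊥-elim (<⇒≱ (<ᵇ≡true⇒< e) n≤m)

<ᵇ≡false⇒≥ : ∀ {m n} → (m <ᵇ n) ≡ false → n ≤ m
<ᵇ≡false⇒≥ e = ≮⇒≥ λ m<n → true≢false (trans (sym (<⇒<ᵇ≡true m<n)) e)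
  where
  true≢false : true ≢ false
  true≢false ()

≡⇒≡ᵇ≡true : ∀ {m n} → m ≡ n → (m ≡ᵇ n) ≡ true
≡⇒≡ᵇ≡true {m} {n} m≡n with m ≡ᵇ n | ≡⇒≡ᵇ m n m≡n
... | true | _ = refl

≡ᵇ≡true⇒≡ : ∀ {m n} → (m ≡ᵇ n) ≡ true → m ≡ n
≡ᵇ≡true⇒≡ {m} {n} e = ≡ᵇ⇒≡ m n (subst T (sym e) tt)

≢⇒≡ᵇ≡false : ∀ {m n} → m ≢ n → (m ≡ᵇ n) ≡ false
≢⇒≡ᵇ≡false {m} {n} m≢n with m ≡ᵇ n in e
... | false = refl
... | true = ⊥-elim (m≢n (≡ᵇ≡true⇒≡ e))

≤⇒≤ᵇ≡true : ∀ {m n} → m ≤ n → (m ≤ᵇ n) ≡ true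
≤⇒≤ᵇ≡true {zero} _ = refl
≤⇒≤ᵇ≡true {suc m} m<n = <⇒<ᵇ≡true m<n

>⇒≤ᵇ≡false : ∀ {m n} → n < m → (m ≤ᵇ n) ≡ false
>⇒≤ᵇ≡false {suc m} (s≤s n≤m) = ≥⇒<ᵇ≡false n≤m

All<⇒∉ : All (_< n) xs → n ∉ xs
All<⇒∉ xs<n n∈xs = <-irrefl refl (All.lookup xs<n n∈xs)

Unique-head : Unique (x ∷ xs) → x ∉ xs
Unique-head (x≢xs ∷ _) x∈xs = All.lookup x≢xs x∈xs refl

Unique-++⁻ˡ : ∀ xs → Unique (xs ++ ys) → Unique xs
Unique-++⁻ˡ [] _ = []
Unique-++⁻ˡ (x ∷ xs) (x≢ ∷ u) = ++⁻ˡ xs x≢ ∷ Unique-++⁻ˡ xs u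

Unique-++⁻ʳ : ∀ xs → Unique (xs ++ ys) → Unique ys
Unique-++⁻ʳ [] u = u
Unique-++⁻ʳ (x ∷ xs) (_ ∷ u) = Unique-++⁻ʳ xs u

Unique-++⇒disjoint : ∀ xs → Unique (xs ++ ys) → x ∈ xs → y ∈ ys → x ≢ y
Unique-++⇒disjoint (z ∷ xs) (z≢ ∷ _) (here refl) y∈ = All.lookup z≢ (∈-++⁺ʳ xs y∈)
Unique-++⇒disjoint (z ∷ xs) (_ ∷ u) (there x∈) y∈ = Unique-++⇒disjoint xs u x∈ y∈

Unique-∷ʳ : Unique xs → n ∉ xs → Unique (xs ++ n ∷ [])
Unique-∷ʳ [] _ = [] ∷ []
Unique-∷ʳ (x≢ ∷ u) n∉ = ++⁺ x≢ ((λ x≡n → n∉ (here (sym x≡n))) ∷ []) ∷ Unique-∷ʳ u (n∉ ∘ there)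

Unique-insert : ∀ xs → n ∉ xs ++ ys → Unique (xs ++ ys) → Unique (xs ++ n ∷ ys)
Unique-insert [] n∉ u = All.tabulate (λ y∈ n≡y → n∉ (subst (_∈ _) (sym n≡y) y∈)) ∷ u
Unique-insert (x ∷ xs) n∉ (x≢ ∷ u) =
  ++⁺ (++⁻ˡ xs x≢) ((λ x≡n → n∉ (here (sym x≡n))) ∷ ++⁻ʳ xs x≢) ∷ Unique-insert xs (λ m → n∉ (there m)) u

>-trans : Transitive _>_
>-trans = flip <-trans

Increasing Decreasing : List ℕ → Set
Increasing = Linked _<_
Decreasing = Linked _>_

Increasing⇒All : Increasing (x ∷ xs) → All (x <_) xs
Increasing⇒All [-] = []
Increasing⇒All (x<y ∷ inc) = Linked⇒All <-trans x<y inc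

Decreasing⇒All : Decreasing (x ∷ xs) → All (_< x) xs
Decreasing⇒All [-] = []
Decreasing⇒All (x>y ∷ dec) = Linked⇒All >-trans x>y dec

Decreasing-∷ : All (_< x) xs → Decreasing xs → Decreasing (x ∷ xs)
Decreasing-∷ [] [] = [-]
Decreasing-∷ (y<x ∷ _) dec = y<x ∷ dec

Linked-++⁻ˡ : ∀ {R : ℕ → ℕ → Set} xs → Linked R (xs ++ ys) → Linked R xs
Linked-++⁻ˡ [] _ = []
Linked-++⁻ˡ (x ∷ []) _ = [-]
Linked-++⁻ˡ (x ∷ y ∷ xs) (r ∷ l) = r ∷ Linked-++⁻ˡ (y ∷ xs) l

Linked-++⁻ʳ : ∀ {R : ℕ → ℕ → Set} xs → Linked R (xs ++ ys) → Linked R ys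
Linked-++⁻ʳ [] l = l
Linked-++⁻ʳ (x ∷ xs) l = Linked-++⁻ʳ xs (Linked.tail l)

Linked-∷ʳ : ∀ {R : ℕ → ℕ → Set} → Linked R xs → All (λ z → R z n) xs → Linked R (xs ++ n ∷ [])
Linked-∷ʳ [] _ = [-]
Linked-∷ʳ [-] (r ∷ []) = r ∷ [-]
Linked-∷ʳ (r ∷ l) (_ ∷ rs) = r ∷ Linked-∷ʳ l rs

Linked-∷ʳ⇒All : ∀ {R : ℕ → ℕ → Set} → Transitive R → ∀ xs → Linked R (xs ++ n ∷ []) → All (λ x → R x n) xs
Linked-∷ʳ⇒All tr [] _ = []
Linked-∷ʳ⇒All tr (x ∷ []) (r ∷ _) = r ∷ []
Linked-∷ʳ⇒All tr (x ∷ y ∷ xs) (r ∷ l) with Linked-∷ʳ⇒All tr (y ∷ xs) l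
... | r′ ∷ rs = tr r r′ ∷ r′ ∷ rs

Decreasing-++⇒< : ∀ xs → Decreasing (xs ++ ys) → x ∈ xs → y ∈ ys → y < x
Decreasing-++⇒< (_ ∷ xs) dec (here refl) y∈ = All.lookup (Decreasing⇒All dec) (∈-++⁺ʳ xs y∈)
Decreasing-++⇒< (_ ∷ xs) dec (there x∈) y∈ = Decreasing-++⇒< xs (Linked.tail dec) x∈ y∈

asc : List ℕ → ℕ
asc [] = 0
asc (x ∷ []) = 0
asc (x ∷ y ∷ ys) = χ (x <ᵇ y) + asc (y ∷ ys)

des-Increasing : Increasing xs → des xs ≡ 0
des-Increasing [] = refl
des-Increasing [-] = refl
des-Increasing (x<y ∷ inc) rewrite ≥⇒<ᵇ≡false (<⇒≤ x<y) = des-Increasing inc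

asc-Decreasing : Decreasing xs → asc xs ≡ 0
asc-Decreasing [] = refl
asc-Decreasing [-] = refl
asc-Decreasing (x>y ∷ dec) rewrite ≥⇒<ᵇ≡false (<⇒≤ x>y) = asc-Decreasing dec

des-Decreasing : Decreasing xs → des xs ≡ length xs ∸ 1
des-Decreasing [] = refl
des-Decreasing [-] = refl
des-Decreasing (x>y ∷ dec) rewrite <⇒<ᵇ≡true x>y | des-Decreasing dec = refl

des≡0⇒Increasing : Unique xs → des xs ≡ 0 → Increasing xs
des≡0⇒Increasing {[]} _ _ = []
des≡0⇒Increasing {x ∷ []} _ _ = [-]
des≡0⇒Increasing {x ∷ y ∷ ys} u@(_ ∷ u′) e with y <ᵇ x in y<ᵇx
... | false = ≤∧≢⇒< (<ᵇ≡false⇒≥ y<ᵇx) (λ x≡y → Unique-head u (here x≡y)) ∷ des≡0⇒Increasing u′ e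

asc≡0⇒Decreasing : Unique xs → asc xs ≡ 0 → Decreasing xs
asc≡0⇒Decreasing {[]} _ _ = []
asc≡0⇒Decreasing {x ∷ []} _ _ = [-]
asc≡0⇒Decreasing {x ∷ y ∷ ys} u@(_ ∷ u′) e with x <ᵇ y in x<ᵇy
... | false = ≤∧≢⇒< (<ᵇ≡false⇒≥ x<ᵇy) (λ y≡x → Unique-head u (here (sym y≡x))) ∷ asc≡0⇒Decreasing u′ e

des+asc≡length∸1 : Unique xs → des xs + asc xs ≡ length xs ∸ 1
des+asc≡length∸1 {[]} _ = refl
des+asc≡length∸1 {x ∷ []} _ = refl
des+asc≡length∸1 {x ∷ y ∷ ys} u@(_ ∷ u′) with <-cmp x y
... | tri< x<y _ _ rewrite <⇒<ᵇ≡true x<y | ≥⇒<ᵇ≡false (<⇒≤ x<y) =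
  trans (+-suc (des (y ∷ ys)) (asc (y ∷ ys))) (cong suc (des+asc≡length∸1 u′))
... | tri≈ _ x≡y _ = ⊥-elim (Unique-head u (here x≡y))
... | tri> _ _ x>y rewrite <⇒<ᵇ≡true x>y | ≥⇒<ᵇ≡false (<⇒≤ x>y) = cong suc (des+asc≡length∸1 u′)

des-∷-min : All (x ≤_) xs → des (x ∷ xs) ≡ des xs
des-∷-min [] = refl
des-∷-min (x≤y ∷ _) rewrite ≥⇒<ᵇ≡false x≤y = refl

des-++-∷ : ∀ xs y ys → des (xs ++ y ∷ ys) ≡ des (xs ++ y ∷ []) + des (y ∷ ys)
des-++-∷ [] y ys = refl
des-++-∷ (x ∷ []) y ys = cong (_+ des (y ∷ ys)) (sym (+-identityʳ (χ (y <ᵇ x))))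
des-++-∷ (x ∷ x′ ∷ xs) y ys rewrite des-++-∷ (x′ ∷ xs) y ys =
  sym (+-assoc (χ (x′ <ᵇ x)) (des (x′ ∷ xs ++ y ∷ [])) (des (y ∷ ys)))

des-∷ʳ-max : ∀ xs → All (_< n) xs → des (xs ++ n ∷ []) ≡ des xs
des-∷ʳ-max [] _ = refl
des-∷ʳ-max (x ∷ []) (x<n ∷ []) rewrite ≥⇒<ᵇ≡false (<⇒≤ x<n) = refl
des-∷ʳ-max (x ∷ y ∷ xs) (_ ∷ xs<n) = cong (χ (y <ᵇ x) +_) (des-∷ʳ-max (y ∷ xs) xs<n)

des-∷ʳ-min : ∀ x xs → All (n <_) (x ∷ xs) → des ((x ∷ xs) ++ n ∷ []) ≡ suc (des (x ∷ xs))
des-∷ʳ-min x [] (n<x ∷ []) rewrite <⇒<ᵇ≡true n<x = refl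
des-∷ʳ-min x (y ∷ xs) (_ ∷ n<xs) rewrite des-∷ʳ-min y xs n<xs = +-suc _ _

des-insert-max : ∀ xs ys → All (_< n) (xs ++ ys) → des (xs ++ ys) ≤ des (xs ++ n ∷ ys)
des-insert-max [] [] _ = z≤n
des-insert-max [] (y ∷ ys) (y<n ∷ _) rewrite <⇒<ᵇ≡true y<n = n≤1+n (des (y ∷ ys))
des-insert-max (x ∷ []) [] _ = z≤n
des-insert-max (x ∷ []) (y ∷ ys) (x<n ∷ y<n ∷ _) rewrite ≥⇒<ᵇ≡false (<⇒≤ x<n) | <⇒<ᵇ≡true y<n =
  +-monoˡ-≤ (des (y ∷ ys)) (χ≤1 (y <ᵇ x))
des-insert-max (x ∷ x′ ∷ xs) ys (_ ∷ <n) = +-monoʳ-≤ (χ (x′ <ᵇ x)) (des-insert-max (x′ ∷ xs) ys <n)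

asc-insert-max : ∀ xs ys → All (_< n) (xs ++ ys) → asc (xs ++ ys) ≤ asc (xs ++ n ∷ ys)
asc-insert-max [] [] _ = z≤n
asc-insert-max {n} [] (y ∷ ys) (y<n ∷ _) rewrite ≥⇒<ᵇ≡false {n} {y} (<⇒≤ y<n) = ≤-refl
asc-insert-max (x ∷ []) [] _ = z≤n
asc-insert-max {n} (x ∷ []) (y ∷ ys) (x<n ∷ y<n ∷ _) rewrite <⇒<ᵇ≡true x<n | ≥⇒<ᵇ≡false {n} {y} (<⇒≤ y<n) =
  +-monoˡ-≤ (asc (y ∷ ys)) (χ≤1 (x <ᵇ y))
asc-insert-max (x ∷ x′ ∷ xs) ys (_ ∷ <n) = +-monoʳ-≤ (χ (x <ᵇ x′)) (asc-insert-max (x′ ∷ xs) ys <n)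

countLess-mono : ∀ xs → x ≤ y → countLess x xs ≤ countLess y xs
countLess-mono [] _ = z≤n
countLess-mono {x} {y} (z ∷ xs) x≤y with z <ᵇ x in z<ᵇx | z <ᵇ y in z<ᵇy
... | true | true = s≤s (countLess-mono xs x≤y)
... | false | false = countLess-mono xs x≤y
... | false | true = m≤n⇒m≤1+n (countLess-mono xs x≤y)
... | true | false = ⊥-elim (<⇒≱ (<-≤-trans (<ᵇ≡true⇒< z<ᵇx) x≤y) (<ᵇ≡false⇒≥ z<ᵇy))

countLess-≤length : ∀ x xs → countLess x xs ≤ length xs
countLess-≤length x [] = z≤n
countLess-≤length x (y ∷ xs) with y <ᵇ x
... | true = s≤s (countLess-≤length x xs)
... | false = m≤n⇒m≤1+n (countLess-≤length x xs)

countLess-<-∈ : ∀ {x y xs} → x ∈ xs → x < y → countLess x xs < countLess y xs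
countLess-<-∈ {x} {xs = _ ∷ xs} (here refl) x<y rewrite ≥⇒<ᵇ≡false {x} ≤-refl | <⇒<ᵇ≡true x<y =
  s≤s (countLess-mono xs (<⇒≤ x<y))
countLess-<-∈ {x} {y} {z ∷ xs} (there x∈xs) x<y with z <ᵇ x in z<ᵇx | z <ᵇ y in z<ᵇy
... | true | true = s≤s (countLess-<-∈ x∈xs x<y)
... | false | false = countLess-<-∈ x∈xs x<y
... | false | true = m≤n⇒m≤1+n (countLess-<-∈ x∈xs x<y)
... | true | false = ⊥-elim (<⇒≱ (<-trans (<ᵇ≡true⇒< z<ᵇx) x<y) (<ᵇ≡false⇒≥ z<ᵇy))

countLess-<length : ∀ {x xs} → x ∈ xs → countLess x xs < length xs
countLess-<length {x} {_ ∷ xs} (here refl) rewrite ≥⇒<ᵇ≡false {x} ≤-refl = s≤s (countLess-≤length x xs)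
countLess-<length {x} {z ∷ xs} (there x∈xs) with z <ᵇ x
... | true = s≤s (countLess-<length x∈xs)
... | false = m≤n⇒m≤1+n (countLess-<length x∈xs)

countLess-≡0 : All (x ≤_) xs → countLess x xs ≡ 0
countLess-≡0 [] = refl
countLess-≡0 (x≤y ∷ x≤ys) rewrite ≥⇒<ᵇ≡false x≤y = countLess-≡0 x≤ys

countLess-≡length : All (_< x) xs → countLess x xs ≡ length xs
countLess-≡length [] = refl
countLess-≡length (y<x ∷ ys<x) rewrite <⇒<ᵇ≡true y<x = cong suc (countLess-≡length ys<x)

countLess-insert : ∀ x n xs ys → countLess x (xs ++ n ∷ ys) ≡ χ (n <ᵇ x) + countLess x (xs ++ ys)
countLess-insert x n [] ys = refl
countLess-insert x n (y ∷ xs) ys rewrite countLess-insert x n xs ys =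
  x∙yz≈y∙xz (χ (y <ᵇ x)) (χ (n <ᵇ x)) (countLess x (xs ++ ys))

record OrderPreservingOn (g : ℕ → ℕ) (xs : List ℕ) : Set where
  constructor orderPreserving
  field preserves : ∀ {x y} → x ∈ xs → y ∈ xs → (g x <ᵇ g y) ≡ (x <ᵇ y)
open OrderPreservingOn

module _ {g : ℕ → ℕ} where

  OrderPreservingOn-⊆ : xs ⊆ ys → OrderPreservingOn g ys → OrderPreservingOn g xs
  OrderPreservingOn-⊆ xs⊆ys op = orderPreserving λ x∈ y∈ → preserves op (xs⊆ys x∈) (xs⊆ys y∈)

  OrderPreservingOn-injective : OrderPreservingOn g xs → x ∈ xs → y ∈ xs → g x ≡ g y → x ≡ y
  OrderPreservingOn-injective {x = x} {y} op x∈ y∈ gx≡gy with <-cmp x y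
  ... | tri≈ _ x≡y _ = x≡y
  ... | tri< x<y _ _ = ⊥-elim (<-irrefl gx≡gy (<ᵇ≡true⇒< (trans (preserves op x∈ y∈) (<⇒<ᵇ≡true x<y))))
  ... | tri> _ _ x>y = ⊥-elim (<-irrefl (sym gx≡gy) (<ᵇ≡true⇒< (trans (preserves op y∈ x∈) (<⇒<ᵇ≡true x>y))))

  des-map : ∀ xs → OrderPreservingOn g xs → des (map g xs) ≡ des xs
  des-map [] _ = refl
  des-map (x ∷ []) _ = refl
  des-map (x ∷ y ∷ xs) op = cong₂ (λ b r → χ b + r) (preserves op (there (here refl)) (here refl)) (des-map (y ∷ xs) (OrderPreservingOn-⊆ there op))

  Increasing-map : OrderPreservingOn g xs → Increasing xs → Increasing (map g xs)
  Increasing-map op [] = []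
  Increasing-map op [-] = [-]
  Increasing-map op (x<y ∷ inc) =
    <ᵇ≡true⇒< (trans (preserves op (here refl) (there (here refl))) (<⇒<ᵇ≡true x<y)) ∷ Increasing-map (OrderPreservingOn-⊆ there op) inc

  Decreasing-map : OrderPreservingOn g xs → Decreasing xs → Decreasing (map g xs)
  Decreasing-map op [] = []
  Decreasing-map op [-] = [-]
  Decreasing-map op (x>y ∷ dec) =
    <ᵇ≡true⇒< (trans (preserves op (there (here refl)) (here refl)) (<⇒<ᵇ≡true x>y)) ∷ Decreasing-map (OrderPreservingOn-⊆ there op) dec

  Unique-map : OrderPreservingOn g xs → Unique xs → Unique (map g xs)
  Unique-map op [] = []
  Unique-map {x ∷ xs} op (x≢ ∷ u) = All.tabulate gx∉ ∷ Unique-map (OrderPreservingOn-⊆ there op) u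
    where
    gx∉ : ∀ {z} → z ∈ map g xs → g x ≢ z
    gx∉ z∈ gx≡z with ∈-map⁻ g z∈
    ... | y , y∈ , refl = All.lookup x≢ y∈ (OrderPreservingOn-injective op (here refl) (there y∈) gx≡z)

  countLess-map : ∀ y xs → OrderPreservingOn g (y ∷ xs) → countLess (g y) (map g xs) ≡ countLess y xs
  countLess-map y [] _ = refl
  countLess-map y (x ∷ xs) op =
    cong₂ (λ b r → χ b + r) (preserves op (there (here refl)) (here refl)) (countLess-map y xs (OrderPreservingOn-⊆ y∷xs⊆ op))
    where
    y∷xs⊆ : y ∷ xs ⊆ y ∷ x ∷ xs
    y∷xs⊆ (here e) = here e
    y∷xs⊆ (there z∈) = there (there z∈)

rank : List ℕ → ℕ → ℕ
rank xs x = suc (countLess x xs)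

rank-orderPreserving : ∀ xs → OrderPreservingOn (rank xs) xs
rank-orderPreserving xs = orderPreserving preserves-<
  where
  preserves-< : ∀ {x y} → x ∈ xs → y ∈ xs → (rank xs x <ᵇ rank xs y) ≡ (x <ᵇ y)
  preserves-< {x} {y} x∈ y∈ with x <ᵇ y in x<ᵇy
  ... | true = <⇒<ᵇ≡true (s≤s (countLess-<-∈ x∈ (<ᵇ≡true⇒< x<ᵇy)))
  ... | false = ≥⇒<ᵇ≡false (s≤s (countLess-mono xs (<ᵇ≡false⇒≥ x<ᵇy)))

rank-≤length : ∀ {x} xs → x ∈ xs → rank xs x ≤ length xs
rank-≤length xs x∈ = countLess-<length x∈

idPerm-suc : ∀ n → idPerm (suc n) ≡ 1 ∷ map suc (idPerm n)
idPerm-suc n = cong (λ l → 1 ∷ map suc l) (sym (map-applyUpTo (λ x → x) suc n))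

decPerm-suc : ∀ n → decPerm (suc n) ≡ suc n ∷ decPerm n
decPerm-suc n = begin
  reverse (map suc (upTo (suc n)))          ≡⟨ cong (λ l → reverse (map suc l)) (sym (upTo-∷ʳ n)) ⟩
  reverse (map suc (upTo n ++ n ∷ []))      ≡⟨ cong reverse (map-++ suc (upTo n) (n ∷ [])) ⟩
  reverse (map suc (upTo n) ++ suc n ∷ [])  ≡⟨ reverse-++ (map suc (upTo n)) (suc n ∷ []) ⟩
  suc n ∷ decPerm n                         ∎
  where open ≡-Reasoning

length-idPerm : ∀ n → length (idPerm n) ≡ n
length-idPerm n = trans (length-map suc (upTo n)) (length-upTo n)

des-map-suc : ∀ xs → des (map suc xs) ≡ des xs
des-map-suc [] = refl
des-map-suc (x ∷ []) = refl
des-map-suc (x ∷ y ∷ xs) = cong (χ (y <ᵇ x) +_) (des-map-suc (y ∷ xs))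

des-idPerm : ∀ n → des (idPerm n) ≡ 0
des-idPerm zero = refl
des-idPerm (suc n) rewrite idPerm-suc n = des-1∷ (idPerm n) (des-idPerm n)
  where
  des-1∷ : ∀ xs → des xs ≡ 0 → des (1 ∷ map suc xs) ≡ 0
  des-1∷ [] _ = refl
  des-1∷ (y ∷ xs) e = trans (des-map-suc (y ∷ xs)) e

des-decPerm : ∀ n → des (decPerm n) ≡ n ∸ 1
des-decPerm zero = refl
des-decPerm (suc zero) = refl
des-decPerm (suc (suc n)) = begin
  des (decPerm (2 + n))                                ≡⟨ cong des (decPerm-suc (suc n)) ⟩
  des (2 + n ∷ decPerm (suc n))                        ≡⟨ cong (λ l → des (2 + n ∷ l)) (decPerm-suc n) ⟩
  χ (1 + n <ᵇ 2 + n) + des (1 + n ∷ decPerm n)         ≡⟨ cong (λ b → χ b + des (1 + n ∷ decPerm n)) (<⇒<ᵇ≡true (n<1+n (suc n))) ⟩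
  suc (des (1 + n ∷ decPerm n))                        ≡⟨ cong (suc ∘ des) (sym (decPerm-suc n)) ⟩
  suc (des (decPerm (suc n)))                          ≡⟨ cong suc (des-decPerm (suc n)) ⟩
  suc n                                                ∎
  where open ≡-Reasoning

==ₗ⇒≡ : ∀ xs ys → (xs ==ₗ ys) ≡ true → xs ≡ ys
==ₗ⇒≡ [] [] _ = refl
==ₗ⇒≡ (x ∷ xs) (y ∷ ys) e with x ≡ᵇ y in x≡ᵇy
... | true = cong₂ _∷_ (≡ᵇ≡true⇒≡ x≡ᵇy) (==ₗ⇒≡ xs ys e)

==ₗ-refl : ∀ xs → (xs ==ₗ xs) ≡ true
==ₗ-refl [] = refl
==ₗ-refl (x ∷ xs) rewrite ≡⇒≡ᵇ≡true {x} refl = ==ₗ-refl xs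

isIdOrDec : List ℕ → Bool
isIdOrDec π = (π ==ₗ idPerm (length π)) ∨ (π ==ₗ decPerm (length π))

isIdOrDec≡false : ∀ π → des π ≢ 0 → des π ≢ length π ∸ 1 → isIdOrDec π ≡ false
isIdOrDec≡false π des≢0 des≢max with π ==ₗ idPerm (length π) in isId
... | true = ⊥-elim (des≢0 (trans (cong des (==ₗ⇒≡ π _ isId)) (des-idPerm (length π))))
... | false with π ==ₗ decPerm (length π) in isDec
...   | true = ⊥-elim (des≢max (trans (cong des (==ₗ⇒≡ π _ isDec)) (des-decPerm (length π))))
...   | false = refl

st-Increasing : Increasing xs → st xs ≡ idPerm (length xs)
st-Increasing [] = refl
st-Increasing {x ∷ xs} inc
  rewrite idPerm-suc (length xs) | ≥⇒<ᵇ≡false {x} ≤-refl | countLess-≡0 (All.map <⇒≤ (Increasing⇒All inc)) =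
  cong (1 ∷_) (trans (map-cong-local (All.map rank-step (Increasing⇒All inc)))
                     (trans (map-∘ xs) (cong (map suc) (st-Increasing (Linked.tail inc)))))
  where
  rank-step : ∀ {y} → x < y → rank (x ∷ xs) y ≡ suc (rank xs y)
  rank-step x<y rewrite <⇒<ᵇ≡true x<y = refl

st-[_] : ∀ x → st (x ∷ []) ≡ 1 ∷ []
st-[ x ] rewrite ≥⇒<ᵇ≡false {x} ≤-refl = refl

splitAt-++-∷ : ∀ c xs ys → All (_≢ c) xs → splitAt c (xs ++ c ∷ ys) ≡ (xs , ys)
splitAt-++-∷ c [] ys _ rewrite ≡⇒≡ᵇ≡true {c} refl = refl
splitAt-++-∷ c (x ∷ xs) ys (x≢c ∷ xs≢c) rewrite ≢⇒≡ᵇ≡false x≢c | splitAt-++-∷ c xs ys xs≢c = refl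

pieceWeight : ℕ → List ℕ → ℕ
pieceWeight f p = wF f (st p) + des p

piecesWeightF : ℕ → ℕ → List ℕ → ℕ
piecesWeightF f k xs = sum (map (pieceWeight f) (piecesF k xs))

piecesWeight : ℕ → List ℕ → ℕ
piecesWeight f xs = piecesWeightF f (length xs) xs

wF-unfold : ∀ f π {πL πR} → splitAt 1 (π ++ suc (length π) ∷ []) ≡ (πL , πR) →
  wF (suc f) π ≡ (if isIdOrDec π then 0 else wF f (st πR) + des πR + piecesWeight f πL)
wF-unfold f π eq rewrite eq = refl

wF-isIdOrDec : ∀ f π → isIdOrDec π ≡ true → wF (suc f) π ≡ 0
wF-isIdOrDec f π e with isIdOrDec π
wF-isIdOrDec f π refl | true = refl

des-st : ∀ u → des (st u) ≡ des u
des-st u = des-map u (rank-orderPreserving u)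

wF-st-resolve : ∀ f u {g v} → wF (suc f) (st u) ≡ (if isIdOrDec (st u) then 0 else g) → g ≡ v →
  v ≡ 0 ⊎ (des u ≢ 0 × des u ≢ length u ∸ 1) → wF (suc f) (st u) ≡ v
wF-st-resolve f u unfold refl (inj₁ refl) = trans unfold (if-0-0 (isIdOrDec (st u)))
  where
  if-0-0 : ∀ b → (if b then 0 else 0) ≡ 0
  if-0-0 true = refl
  if-0-0 false = refl
wF-st-resolve f u unfold refl (inj₂ (des≢0 , des≢length∸1))
  rewrite isIdOrDec≡false (st u) (des≢0 ∘ trans (sym (des-st u)))
                                 (λ e → des≢length∸1 (trans (sym (des-st u)) (trans e (cong (_∸ 1) (length-map (rank u) u))))) =
  unfold

wF-idPerm : ∀ f n → wF f (idPerm n) ≡ 0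
wF-idPerm zero n = refl
wF-idPerm (suc f) n = wF-isIdOrDec f (idPerm n) isId
  where
  isId : isIdOrDec (idPerm n) ≡ true
  isId rewrite length-idPerm n | ==ₗ-refl (idPerm n) = refl

wF-[1] : ∀ f → wF f (1 ∷ []) ≡ 0
wF-[1] zero = refl
wF-[1] (suc f) = refl

wF-st-Increasing : ∀ f → Increasing xs → wF f (st xs) ≡ 0
wF-st-Increasing {xs} f inc rewrite st-Increasing inc = wF-idPerm f (length xs)

pieceWeight-[_] : ∀ x f → pieceWeight f (x ∷ []) ≡ 0
pieceWeight-[ x ] f rewrite st-[ x ] | wF-[1] f = refl

-- In st u the letter 1 sits where the minimum m of u = X ++ m ∷ Y does, so the recursion
-- cuts st u into the relabellings of X and of Y (followed by the new maximum M).
module MinimumSplit (u X : List ℕ) (m : ℕ) (Y : List ℕ) (u≡ : u ≡ X ++ m ∷ Y)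
                    (m<X : All (m <_) X) (m<Y : All (m <_) Y) where

  s : ℕ → ℕ
  s = rank u

  M : ℕ
  M = suc (length u)

  Y⁺ : List ℕ
  Y⁺ = map s Y ++ M ∷ []

  X⊆u : X ⊆ u
  X⊆u x∈ = subst (_ ∈_) (sym u≡) (∈-++⁺ˡ x∈)

  Y⊆u : Y ⊆ u
  Y⊆u y∈ = subst (_ ∈_) (sym u≡) (∈-++⁺ʳ X (there y∈))

  s-orderPreservingˣ : OrderPreservingOn s X
  s-orderPreservingˣ = OrderPreservingOn-⊆ X⊆u (rank-orderPreserving u)

  s-orderPreservingʸ : OrderPreservingOn s Y
  s-orderPreservingʸ = OrderPreservingOn-⊆ Y⊆u (rank-orderPreserving u)

  sY<M : All (_< M) (map s Y)
  sY<M = All.map⁺ (All.tabulate (λ y∈ → s≤s (rank-≤length u (Y⊆u y∈))))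

  private
    m≤u : All (m ≤_) u
    m≤u = subst (All (m ≤_)) (sym u≡) (++⁺ (All.map <⇒≤ m<X) (≤-refl ∷ All.map <⇒≤ m<Y))

    m∈u : m ∈ u
    m∈u = subst (m ∈_) (sym u≡) (∈-++⁺ʳ X (here refl))

    s-m≡1 : s m ≡ 1
    s-m≡1 = cong suc (countLess-≡0 m≤u)

    s-X≢1 : All (_≢ 1) (map s X)
    s-X≢1 = All.map⁺ (All.tabulate λ x∈ sx≡1 →
      <-irrefl (sym (suc-injective sx≡1)) (≤-<-trans z≤n (countLess-<-∈ m∈u (All.lookup m<X x∈))))

    split : splitAt 1 (st u ++ suc (length (st u)) ∷ []) ≡ (map s X , Y⁺)
    split = begin
      splitAt 1 (map s u ++ suc (length (map s u)) ∷ [])  ≡⟨ cong (λ k → splitAt 1 (map s u ++ suc k ∷ [])) (length-map s u) ⟩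
      splitAt 1 (map s u ++ M ∷ [])                       ≡⟨ cong (λ l → splitAt 1 (map s l ++ M ∷ [])) u≡ ⟩
      splitAt 1 (map s (X ++ m ∷ Y) ++ M ∷ [])            ≡⟨ cong (λ l → splitAt 1 (l ++ M ∷ [])) (map-++ s X (m ∷ Y)) ⟩
      splitAt 1 ((map s X ++ s m ∷ map s Y) ++ M ∷ [])    ≡⟨ cong (splitAt 1) (++-assoc (map s X) (s m ∷ map s Y) (M ∷ [])) ⟩
      splitAt 1 (map s X ++ s m ∷ Y⁺)                     ≡⟨ cong (λ k → splitAt 1 (map s X ++ k ∷ Y⁺)) s-m≡1 ⟩
      splitAt 1 (map s X ++ 1 ∷ Y⁺)                       ≡⟨ splitAt-++-∷ 1 (map s X) Y⁺ s-X≢1 ⟩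
      (map s X , Y⁺)                                      ∎
      where open ≡-Reasoning

  wF-st-unfold : ∀ f → wF (suc f) (st u) ≡
    (if isIdOrDec (st u) then 0 else wF f (st Y⁺) + des Y⁺ + piecesWeight f (map s X))
  wF-st-unfold f = wF-unfold f (st u) split

maxL-≤ : ∀ xs → All (_≤ n) xs → maxL xs ≤ n
maxL-≤ [] _ = z≤n
maxL-≤ (x ∷ xs) (x≤n ∷ xs≤n) = ⊔-lub x≤n (maxL-≤ xs xs≤n)

maxL-++-∷ : ∀ xs b ys → All (_< b) xs → All (_< b) ys → maxL (xs ++ b ∷ ys) ≡ b
maxL-++-∷ xs b ys xs<b ys<b =
  ≤-antisym (maxL-≤ (xs ++ b ∷ ys) (++⁺ (All.map <⇒≤ xs<b) (≤-refl ∷ All.map <⇒≤ ys<b))) (b≤maxL xs)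
  where
  b≤maxL : ∀ xs → b ≤ maxL (xs ++ b ∷ ys)
  b≤maxL [] = m≤m⊔n b (maxL ys)
  b≤maxL (x ∷ xs) = ≤-trans (b≤maxL xs) (m≤n⊔m x (maxL (xs ++ b ∷ ys)))

prefixToMax-++-∷ : ∀ xs b ys → All (_< b) xs → All (_< b) ys → prefixToMax (xs ++ b ∷ ys) ≡ (xs ++ b ∷ [] , ys)
prefixToMax-++-∷ xs b ys xs<b ys<b
  rewrite maxL-++-∷ xs b ys xs<b ys<b | splitAt-++-∷ b xs ys (All.map <⇒≢ xs<b) = refl

piecesF-∷ : ∀ k x xs {p r} → prefixToMax (x ∷ xs) ≡ (p , r) → piecesF (suc k) (x ∷ xs) ≡ p ∷ piecesF k r
piecesF-∷ k x xs e = cong₂ (λ p r → p ∷ piecesF k r) (cong proj₁ e) (cong proj₂ e)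

piecesF-++-∷ : ∀ k xs b ys → All (_< b) xs → All (_< b) ys → piecesF (suc k) (xs ++ b ∷ ys) ≡ (xs ++ b ∷ []) ∷ piecesF k ys
piecesF-++-∷ k [] b ys xs<b ys<b = piecesF-∷ k b ys (prefixToMax-++-∷ [] b ys xs<b ys<b)
piecesF-++-∷ k (x ∷ xs) b ys xs<b ys<b = piecesF-∷ k x (xs ++ b ∷ ys) (prefixToMax-++-∷ (x ∷ xs) b ys xs<b ys<b)

piecesF-[] : ∀ k → piecesF k [] ≡ []
piecesF-[] zero = refl
piecesF-[] (suc k) = refl

piecesWeightF-Decreasing : ∀ f k xs → Decreasing xs → length xs ≤ k → piecesWeightF f k xs ≡ 0
piecesWeightF-Decreasing f zero xs _ _ = refl
piecesWeightF-Decreasing f (suc k) [] _ _ = refl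
piecesWeightF-Decreasing f (suc k) (x ∷ xs) dec (s≤s len≤k) = begin
  sum (map (pieceWeight f) (piecesF (suc k) (x ∷ xs)))  ≡⟨ cong (sum ∘ map (pieceWeight f)) (piecesF-++-∷ k [] x xs [] (Decreasing⇒All dec)) ⟩
  pieceWeight f (x ∷ []) + piecesWeightF f k xs         ≡⟨ cong₂ _+_ (pieceWeight-[ x ] f) (piecesWeightF-Decreasing f k xs (Linked.tail dec) len≤k) ⟩
  0                                                     ∎
  where open ≡-Reasoning

pieces-Increasing : Increasing (x ∷ xs) → pieces (x ∷ xs) ≡ (x ∷ xs) ∷ []
pieces-Increasing {x} {xs} inc = piecesF-Increasing (length xs) inc (λ ())
  where
  piecesF-Increasing : ∀ k {ys} → Increasing ys → ys ≢ [] → piecesF (suc k) ys ≡ ys ∷ []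
  piecesF-Increasing k {ys} inc ys≢[] with initLast ys
  ... | [] = ⊥-elim (ys≢[] refl)
  ... | zs ∷ʳ′ t rewrite piecesF-++-∷ k zs t [] (Linked-∷ʳ⇒All <-trans zs inc) [] | piecesF-[] k = refl

piecesWeight-Increasing : ∀ f → Increasing (x ∷ xs) → piecesWeight f (x ∷ xs) ≡ 0
piecesWeight-Increasing {x} {xs} f inc = begin
  sum (map (pieceWeight f) (pieces (x ∷ xs)))  ≡⟨ cong (sum ∘ map (pieceWeight f)) (pieces-Increasing inc) ⟩
  wF f (st (x ∷ xs)) + des (x ∷ xs) + 0        ≡⟨ cong₂ (λ a b → a + b + 0) (wF-st-Increasing f inc) (des-Increasing inc) ⟩
  0                                            ∎
  where open ≡-Reasoning

wF-st-Decreasing-∷ʳ-max : ∀ f D t → Decreasing D → All (_< t) D → wF f (st (D ++ t ∷ [])) ≡ 0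
wF-st-Decreasing-∷ʳ-max zero D t _ _ = refl
wF-st-Decreasing-∷ʳ-max (suc f) D t dec D<t with initLast D
... | [] = trans (cong (wF (suc f)) st-[ t ]) (wF-[1] (suc f))
... | D₀ ∷ʳ′ d = wF-st-resolve f ((D₀ ++ d ∷ []) ++ t ∷ []) (wF-st-unfold f) rest≡0 (inj₁ refl)
  where
  d<D₀ : All (d <_) D₀
  d<D₀ = Linked-∷ʳ⇒All >-trans D₀ dec
  d<t : d < t
  d<t = All.lookup D<t (∈-++⁺ʳ D₀ (here refl))
  open MinimumSplit ((D₀ ++ d ∷ []) ++ t ∷ []) D₀ d (t ∷ []) (++-assoc D₀ (d ∷ []) (t ∷ [])) d<D₀ (d<t ∷ [])
  Y⁺-increasing : Increasing Y⁺
  Y⁺-increasing = All.head sY<M ∷ [-]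
  rest≡0 : wF f (st Y⁺) + des Y⁺ + piecesWeight f (map s D₀) ≡ 0
  rest≡0 rewrite wF-st-Increasing f Y⁺-increasing | des-Increasing Y⁺-increasing =
    piecesWeightF-Decreasing f _ (map s D₀) (Decreasing-map s-orderPreservingˣ (Linked-++⁻ˡ D₀ dec)) ≤-refl

piecesWeightF-Decreasing-++-Decreasing : ∀ f k A b B → Decreasing A → Decreasing (b ∷ B) → Unique (A ++ b ∷ B) →
  length (A ++ b ∷ B) ≤ k → piecesWeightF f k (A ++ b ∷ B) ≡ countLess b A ∸ 1
piecesWeightF-Decreasing-++-Decreasing f k [] b B _ decB _ len≤k = piecesWeightF-Decreasing f k (b ∷ B) decB len≤k
piecesWeightF-Decreasing-++-Decreasing f (suc k) (x ∷ A) b B decA decB (x≢ ∷ u) (s≤s len≤k) with b <ᵇ x in b<ᵇx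
... | true rewrite ≥⇒<ᵇ≡false {x} {b} (<⇒≤ (<ᵇ≡true⇒< b<ᵇx)) = begin
  sum (map (pieceWeight f) (piecesF (suc k) (x ∷ A ++ b ∷ B)))
    ≡⟨ cong (sum ∘ map (pieceWeight f)) (piecesF-++-∷ k [] x (A ++ b ∷ B) [] rest<x) ⟩
  pieceWeight f (x ∷ []) + piecesWeightF f k (A ++ b ∷ B)
    ≡⟨ cong₂ _+_ (pieceWeight-[ x ] f) (piecesWeightF-Decreasing-++-Decreasing f k A b B (Linked.tail decA) decB u len≤k) ⟩
  countLess b A ∸ 1 ∎
  where
  open ≡-Reasoning
  b<x : b < x
  b<x = <ᵇ≡true⇒< b<ᵇx
  rest<x : All (_< x) (A ++ b ∷ B)
  rest<x = ++⁺ (Decreasing⇒All decA) (b<x ∷ All.map (λ p → <-trans p b<x) (Decreasing⇒All decB))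
... | false = begin
  sum (map (pieceWeight f) (piecesF (suc k) ((x ∷ A) ++ b ∷ B)))
    ≡⟨ cong (sum ∘ map (pieceWeight f)) (piecesF-++-∷ k (x ∷ A) b B xA<b (Decreasing⇒All decB)) ⟩
  pieceWeight f ((x ∷ A) ++ b ∷ []) + piecesWeightF f k B
    ≡⟨ cong₂ _+_ firstPiece (piecesWeightF-Decreasing f k B (Linked.tail decB) B≤k) ⟩
  length A + 0
    ≡⟨ +-identityʳ (length A) ⟩
  length (x ∷ A) ∸ 1
    ≡⟨ cong (_∸ 1) (sym (countLess-≡length xA<b)) ⟩
  countLess b (x ∷ A) ∸ 1 ∎
  where
  open ≡-Reasoning
  x<b : x < b
  x<b = ≤∧≢⇒< (<ᵇ≡false⇒≥ b<ᵇx) (All.lookup x≢ (∈-++⁺ʳ A (here refl)))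
  xA<b : All (_< b) (x ∷ A)
  xA<b = x<b ∷ All.map (λ p → <-trans p x<b) (Decreasing⇒All decA)
  firstPiece : pieceWeight f ((x ∷ A) ++ b ∷ []) ≡ length A
  firstPiece rewrite wF-st-Decreasing-∷ʳ-max f (x ∷ A) b decA xA<b | des-∷ʳ-max (x ∷ A) xA<b | des-Decreasing decA = refl
  B≤k : length B ≤ k
  B≤k = ≤-trans (≤-trans (n≤1+n (length B)) (m≤n+m (suc (length B)) (length A)))
                (≤-trans (≤-reflexive (sym (length-++ A))) len≤k)

-- The weight of a word with one descent

leadingMinima : List ℕ → ℕ
leadingMinima [] = 0
leadingMinima (x ∷ xs) = if all (x <ᵇ_) xs then suc (leadingMinima xs) else 0

all-<ᵇ≡true : All (x <_) xs → all (x <ᵇ_) xs ≡ true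
all-<ᵇ≡true [] = refl
all-<ᵇ≡true (x<y ∷ x<ys) rewrite <⇒<ᵇ≡true x<y = all-<ᵇ≡true x<ys

all-<ᵇ≡true⇒All : ∀ xs → all (x <ᵇ_) xs ≡ true → All (x <_) xs
all-<ᵇ≡true⇒All [] _ = []
all-<ᵇ≡true⇒All {x} (y ∷ xs) e with x <ᵇ y in x<ᵇy
... | true = <ᵇ≡true⇒< x<ᵇy ∷ all-<ᵇ≡true⇒All xs e

all-<ᵇ-∷ʳ : ∀ xs → x < n → all (x <ᵇ_) (xs ++ n ∷ []) ≡ all (x <ᵇ_) xs
all-<ᵇ-∷ʳ [] x<n rewrite <⇒<ᵇ≡true x<n = refl
all-<ᵇ-∷ʳ {x} (y ∷ xs) x<n = cong ((x <ᵇ y) ∧_) (all-<ᵇ-∷ʳ xs x<n)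

all-<ᵇ-map : ∀ {g} x xs → OrderPreservingOn g (x ∷ xs) → all (g x <ᵇ_) (map g xs) ≡ all (x <ᵇ_) xs
all-<ᵇ-map x [] _ = refl
all-<ᵇ-map x (y ∷ xs) op =
  cong₂ _∧_ (preserves op (here refl) (there (here refl))) (all-<ᵇ-map x xs (OrderPreservingOn-⊆ x∷xs⊆ op))
  where
  x∷xs⊆ : x ∷ xs ⊆ x ∷ y ∷ xs
  x∷xs⊆ (here e) = here e
  x∷xs⊆ (there z∈) = there (there z∈)

leadingMinima-map : ∀ {g} xs → OrderPreservingOn g xs → leadingMinima (map g xs) ≡ leadingMinima xs
leadingMinima-map [] _ = refl
leadingMinima-map {g} (x ∷ xs) op rewrite all-<ᵇ-map x xs op with all (x <ᵇ_) xs
... | true = cong suc (leadingMinima-map xs (OrderPreservingOn-⊆ there op))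
... | false = refl

leadingMinima-∷ʳ-max : ∀ xs → All (_< n) xs → 1 ≤ des xs → leadingMinima (xs ++ n ∷ []) ≡ leadingMinima xs
leadingMinima-∷ʳ-max (x ∷ y ∷ xs) (x<n ∷ xs<n) des≥1 rewrite all-<ᵇ-∷ʳ (y ∷ xs) x<n with all (x <ᵇ_) (y ∷ xs) in x<ᵇ
... | false = refl
... | true rewrite ≥⇒<ᵇ≡false (<⇒≤ (All.head (all-<ᵇ≡true⇒All (y ∷ xs) x<ᵇ))) =
  cong suc (leadingMinima-∷ʳ-max (y ∷ xs) xs<n des≥1)

leadingMinima-≤length : ∀ xs → leadingMinima xs ≤ length xs
leadingMinima-≤length [] = z≤n
leadingMinima-≤length (x ∷ xs) with all (x <ᵇ_) xs
... | true = s≤s (leadingMinima-≤length xs)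
... | false = z≤n

minimum-split : ∀ xs → xs ≢ [] → Unique xs →
  ∃[ X ] ∃[ m ] ∃[ Y ] (xs ≡ X ++ m ∷ Y) × All (m <_) X × All (m <_) Y
minimum-split [] xs≢[] _ = ⊥-elim (xs≢[] refl)
minimum-split (x ∷ []) _ _ = [] , x , [] , refl , [] , []
minimum-split (x ∷ y ∷ xs) _ u@(_ ∷ u′) with minimum-split (y ∷ xs) (λ ()) u′
... | X , m , Y , eq , m<X , m<Y with <-cmp x m
...   | tri< x<m _ _ =
  [] , x , y ∷ xs , refl , [] , subst (All (x <_)) (sym eq) (++⁺ (All.map (<-trans x<m) m<X) (x<m ∷ All.map (<-trans x<m) m<Y))
...   | tri≈ _ x≡m _ = ⊥-elim (Unique-head u (subst (_∈ y ∷ xs) (sym x≡m) (subst (m ∈_) (sym eq) (∈-++⁺ʳ X (here refl)))))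
...   | tri> _ _ x>m = x ∷ X , m , Y , cong (x ∷_) eq , x>m ∷ m<X , m<Y

wF-st-Increasing-min-Increasing : ∀ f x X m Y → Increasing (x ∷ X) → Increasing Y → All (m <_) (x ∷ X) → All (m <_) Y →
  wF (suc f) (st ((x ∷ X) ++ m ∷ Y)) ≡ 0
wF-st-Increasing-min-Increasing f x X m Y incX incY m<X m<Y =
  wF-st-resolve f ((x ∷ X) ++ m ∷ Y) (wF-st-unfold f) rest≡0 (inj₁ refl)
  where
  open MinimumSplit ((x ∷ X) ++ m ∷ Y) (x ∷ X) m Y refl m<X m<Y
  incY⁺ : Increasing Y⁺
  incY⁺ = Linked-∷ʳ (Increasing-map s-orderPreservingʸ incY) sY<M
  incX′ : Increasing (s x ∷ map s X)
  incX′ = Increasing-map s-orderPreservingˣ incX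
  rest≡0 : wF f (st Y⁺) + des Y⁺ + piecesWeight f (s x ∷ map s X) ≡ 0
  rest≡0 rewrite wF-st-Increasing f incY⁺ | des-Increasing incY⁺ = piecesWeight-Increasing f incX′

des≡1-at-min : ∀ x X m Y → All (m <_) (x ∷ X) → des ((x ∷ X) ++ m ∷ Y) ≡ 1 → des (x ∷ X) ≡ 0 × des (m ∷ Y) ≡ 0
des≡1-at-min x X m Y m<X des≡1 = m+n≡0⇒m≡0 (des (x ∷ X)) sum≡0 , m+n≡0⇒n≡0 (des (x ∷ X)) sum≡0
  where
  sum≡0 : des (x ∷ X) + des (m ∷ Y) ≡ 0
  sum≡0 = suc-injective (begin
    suc (des (x ∷ X)) + des (m ∷ Y)          ≡⟨ cong (_+ des (m ∷ Y)) (sym (des-∷ʳ-min x X m<X)) ⟩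
    des ((x ∷ X) ++ m ∷ []) + des (m ∷ Y)    ≡⟨ sym (des-++-∷ (x ∷ X) m Y) ⟩
    des ((x ∷ X) ++ m ∷ Y)                   ≡⟨ des≡1 ⟩
    1                                        ∎)
    where open ≡-Reasoning

wF-st-oneDescent : ∀ f u → Unique u → des u ≡ 1 → leadingMinima u < f → wF f (st u) ≡ leadingMinima u
wF-st-oneDescent (suc f) (a ∷ r) u des≡1 fp<f with all (a <ᵇ_) r in a<ᵇr
... | true = wF-st-resolve f (a ∷ r) (wF-st-unfold f) value (inj₂ (des≢0 , des≢length∸1))
  where
  a<r : All (a <_) r
  a<r = all-<ᵇ≡true⇒All r a<ᵇr
  open MinimumSplit (a ∷ r) [] a r refl [] a<r
  des-r : des r ≡ 1
  des-r = trans (sym (des-∷-min (All.map <⇒≤ a<r))) des≡1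
  des-map-r : des (map s r) ≡ 1
  des-map-r = trans (des-map r s-orderPreservingʸ) des-r
  des-Y⁺ : des Y⁺ ≡ 1
  des-Y⁺ = trans (des-∷ʳ-max (map s r) sY<M) des-map-r
  leadingMinima-Y⁺ : leadingMinima Y⁺ ≡ leadingMinima r
  leadingMinima-Y⁺ = trans (leadingMinima-∷ʳ-max (map s r) sY<M (≤-reflexive (sym des-map-r)))
                           (leadingMinima-map r s-orderPreservingʸ)
  unique-Y⁺ : Unique Y⁺
  unique-Y⁺ = Unique-∷ʳ (Unique-map s-orderPreservingʸ (AllPairs.tail u)) (All<⇒∉ sY<M)
  value : wF f (st Y⁺) + des Y⁺ + piecesWeight f [] ≡ suc (leadingMinima r)
  value rewrite wF-st-oneDescent f Y⁺ unique-Y⁺ des-Y⁺ (subst (_< f) (sym leadingMinima-Y⁺) (≤-pred fp<f))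
              | des-Y⁺ | leadingMinima-Y⁺ = trans (+-identityʳ _) (+-comm _ 1)
  des≢0 : des (a ∷ r) ≢ 0
  des≢0 e = 1+n≢0 (trans (sym des≡1) e)
  des≢length∸1 : des (a ∷ r) ≢ length r
  des≢length∸1 e = <-irrefl (trans (sym des≡1) e) (1<length r des-r)
    where
    1<length : ∀ xs → des xs ≡ 1 → 1 < length xs
    1<length (_ ∷ _ ∷ _) _ = s≤s (s≤s z≤n)
... | false with minimum-split (a ∷ r) (λ ()) u
...   | [] , .a , .r , refl , [] , a<r = ⊥-elim (true≢false (trans (sym (all-<ᵇ≡true a<r)) a<ᵇr))
  where
  true≢false : true ≢ false
  true≢false ()
...   | x ∷ X , m , Y , a∷r≡ , m<X , m<Y = trans (cong (wF (suc f) ∘ st) a∷r≡)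
        (wF-st-Increasing-min-Increasing f x X m Y incX (Linked.tail incmY) m<X m<Y)
  where
  u′ : Unique ((x ∷ X) ++ m ∷ Y)
  u′ = subst Unique a∷r≡ u
  des≡0 : des (x ∷ X) ≡ 0 × des (m ∷ Y) ≡ 0
  des≡0 = des≡1-at-min x X m Y m<X (trans (cong des (sym a∷r≡)) des≡1)
  incX : Increasing (x ∷ X)
  incX = des≡0⇒Increasing (Unique-++⁻ˡ (x ∷ X) u′) (proj₁ des≡0)
  incmY : Increasing (m ∷ Y)
  incmY = des≡0⇒Increasing (Unique-++⁻ʳ (x ∷ X) u′) (proj₂ des≡0)

-- The weight of a word with one ascent

lastOr : ℕ → List ℕ → ℕ
lastOr d [] = d
lastOr d (x ∷ xs) = lastOr x xs

headOr : ℕ → List ℕ → ℕ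
headOr d [] = d
headOr d (x ∷ _) = x

lastOr-∈ : ∀ d xs → lastOr d xs ∈ d ∷ xs
lastOr-∈ d [] = here refl
lastOr-∈ d (x ∷ xs) = there (lastOr-∈ x xs)

lastOr-Decreasing : ∀ x xs → Decreasing (x ∷ xs) → All (lastOr x xs ≤_) (x ∷ xs)
lastOr-Decreasing x [] _ = ≤-refl ∷ []
lastOr-Decreasing x (y ∷ xs) dec with lastOr-Decreasing y xs (Linked.tail dec)
... | last≤y ∷ last≤xs = ≤-trans last≤y (<⇒≤ (Linked.head dec)) ∷ last≤y ∷ last≤xs

descentRun : List ℕ → List ℕ × List ℕ
descentRun [] = [] , []
descentRun (x ∷ []) = x ∷ [] , []
descentRun (x ∷ y ∷ ys) = if y <ᵇ x then map₁ (x ∷_) (descentRun (y ∷ ys)) else (x ∷ [] , y ∷ ys)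

endsLower : List ℕ × List ℕ → Bool
endsLower (A , B) = lastOr 0 A <ᵇ lastOr 0 B

oneAscentWeight : List ℕ × List ℕ → ℕ
oneAscentWeight (A , B) = if endsLower (A , B) then length B ∸ 1 else countLess (headOr 0 B) A ∸ 1

record TwoRuns (u : List ℕ) : Set where
  constructor twoRuns
  field
    a : ℕ
    A : List ℕ
    b : ℕ
    B : List ℕ
    u≡ : u ≡ (a ∷ A) ++ b ∷ B
    decreasingˡ : Decreasing (a ∷ A)
    decreasingʳ : Decreasing (b ∷ B)
    ascent : lastOr a A < b

asc≡1⇒TwoRuns : ∀ u → Unique u → asc u ≡ 1 → TwoRuns u
asc≡1⇒TwoRuns (x ∷ y ∷ ys) u@(_ ∷ u′) asc≡1 with x <ᵇ y in x<ᵇy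
... | true = twoRuns x [] y ys refl [-] (asc≡0⇒Decreasing u′ (suc-injective asc≡1)) (<ᵇ≡true⇒< x<ᵇy)
... | false with asc≡1⇒TwoRuns (y ∷ ys) u′ asc≡1
...   | twoRuns .y A b B refl decA decB asc = twoRuns x (y ∷ A) b B refl (y<x ∷ decA) decB asc
  where
  y<x : y < x
  y<x = ≤∧≢⇒< (<ᵇ≡false⇒≥ x<ᵇy) (λ y≡x → Unique-head u (here (sym y≡x)))

descentRun-twoRuns : ∀ a A b B → Decreasing (a ∷ A) → lastOr a A < b → descentRun ((a ∷ A) ++ b ∷ B) ≡ (a ∷ A , b ∷ B)
descentRun-twoRuns a [] b B _ a<b rewrite ≥⇒<ᵇ≡false {b} {a} (<⇒≤ a<b) = refl
descentRun-twoRuns a (a′ ∷ A) b B dec last<b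
  rewrite <⇒<ᵇ≡true (Linked.head dec) | descentRun-twoRuns a′ A b B (Linked.tail dec) last<b = refl

asc-twoRuns : ∀ a A b B → Decreasing (a ∷ A) → Decreasing (b ∷ B) → lastOr a A < b → asc ((a ∷ A) ++ b ∷ B) ≡ 1
asc-twoRuns a [] b B _ decB a<b rewrite <⇒<ᵇ≡true a<b | asc-Decreasing decB = refl
asc-twoRuns a (a′ ∷ A) b B decA decB last<b rewrite ≥⇒<ᵇ≡false {a} {a′} (<⇒≤ (Linked.head decA)) =
  asc-twoRuns a′ A b B (Linked.tail decA) decB last<b

des-∷ʳ-ascent : ∀ a A → lastOr a A < n → des ((a ∷ A) ++ n ∷ []) ≡ des (a ∷ A)
des-∷ʳ-ascent {n} a [] a<n rewrite ≥⇒<ᵇ≡false {n} {a} (<⇒≤ a<n) = refl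
des-∷ʳ-ascent a (a′ ∷ A) last<n = cong (χ (a′ <ᵇ a) +_) (des-∷ʳ-ascent a′ A last<n)

des-twoRuns : ∀ a A b B → Decreasing (a ∷ A) → Decreasing (b ∷ B) → lastOr a A < b → des ((a ∷ A) ++ b ∷ B) ≡ length A + length B
des-twoRuns a A b B decA decB last<b
  rewrite des-++-∷ (a ∷ A) b B | des-∷ʳ-ascent a A last<b | des-Decreasing decA | des-Decreasing decB = refl

∷-init-lastOr : ∀ d xs → ∃[ ys ] (d ∷ xs ≡ ys ++ lastOr d xs ∷ [])
∷-init-lastOr d [] = [] , refl
∷-init-lastOr d (x ∷ xs) with ∷-init-lastOr x xs
... | ys , eq = d ∷ ys , cong (d ∷_) eq

twoRuns-nontrivial : ∀ a A b c cs → Decreasing (a ∷ A) → Decreasing (b ∷ c ∷ cs) → lastOr a A < b →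
  des ((a ∷ A) ++ b ∷ c ∷ cs) ≢ 0 × des ((a ∷ A) ++ b ∷ c ∷ cs) ≢ length ((a ∷ A) ++ b ∷ c ∷ cs) ∸ 1
twoRuns-nontrivial a A b c cs decA decB ascent = des≢0 , des≢length∸1
  where
  des≡ : des ((a ∷ A) ++ b ∷ c ∷ cs) ≡ length A + suc (length cs)
  des≡ = des-twoRuns a A b (c ∷ cs) decA decB ascent
  des≢0 : des ((a ∷ A) ++ b ∷ c ∷ cs) ≢ 0
  des≢0 e = 1+n≢0 (trans (sym (+-suc (length A) (length cs))) (trans (sym des≡) e))
  des≢length∸1 : des ((a ∷ A) ++ b ∷ c ∷ cs) ≢ length ((a ∷ A) ++ b ∷ c ∷ cs) ∸ 1
  des≢length∸1 e = <-irrefl (trans (sym des≡) (trans e (length-++ A))) (+-monoʳ-< (length A) ≤-refl)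

twoRuns-side : ∀ a A b B → Decreasing (a ∷ A) → Decreasing (b ∷ B) → lastOr a A < b →
  length B ≡ 0 ⊎ (des ((a ∷ A) ++ b ∷ B) ≢ 0 × des ((a ∷ A) ++ b ∷ B) ≢ length ((a ∷ A) ++ b ∷ B) ∸ 1)
twoRuns-side a A b [] _ _ _ = inj₁ refl
twoRuns-side a A b (c ∷ cs) decA decB ascent = inj₂ (twoRuns-nontrivial a A b c cs decA decB ascent)

wF-st-twoRuns-endsLower : ∀ f a A b B (decA : Decreasing (a ∷ A)) (decB : Decreasing (b ∷ B)) (ascent : lastOr a A < b) →
  lastOr a A < lastOr b B → wF (suc f) (st ((a ∷ A) ++ b ∷ B)) ≡ length B
wF-st-twoRuns-endsLower f a A b B decA decB ascent lastA<lastB with ∷-init-lastOr a A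
... | A₀ , a∷A≡ = wF-st-resolve f u (wF-st-unfold f) value (twoRuns-side a A b B decA decB ascent)
  where
  u : List ℕ
  u = (a ∷ A) ++ b ∷ B
  lastA : ℕ
  lastA = lastOr a A
  lastA<A₀ : All (lastA <_) A₀
  lastA<A₀ = Linked-∷ʳ⇒All >-trans A₀ (subst Decreasing a∷A≡ decA)
  lastA<b∷B : All (lastA <_) (b ∷ B)
  lastA<b∷B = All.map (<-≤-trans lastA<lastB) (lastOr-Decreasing b B decB)
  open MinimumSplit u A₀ lastA (b ∷ B) (trans (cong (_++ b ∷ B) a∷A≡) (++-assoc A₀ (lastA ∷ []) (b ∷ B))) lastA<A₀ lastA<b∷B
  dec-sb∷B : Decreasing (map s (b ∷ B))
  dec-sb∷B = Decreasing-map s-orderPreservingʸ decB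
  dec-sA₀ : Decreasing (map s A₀)
  dec-sA₀ = Decreasing-map s-orderPreservingˣ (Linked-++⁻ˡ A₀ (subst Decreasing a∷A≡ decA))
  value : wF f (st Y⁺) + des Y⁺ + piecesWeight f (map s A₀) ≡ length B
  value rewrite wF-st-Decreasing-∷ʳ-max f (map s (b ∷ B)) M dec-sb∷B sY<M
              | des-∷ʳ-max (map s (b ∷ B)) sY<M | des-map (b ∷ B) s-orderPreservingʸ | des-Decreasing decB
              | piecesWeightF-Decreasing f (length (map s A₀)) (map s A₀) dec-sA₀ ≤-refl = +-identityʳ _

wF-st-twoRuns-endsHigher : ∀ f a A b B (decA : Decreasing (a ∷ A)) (decB : Decreasing (b ∷ B)) (ascent : lastOr a A < b) →
  Unique ((a ∷ A) ++ b ∷ B) → lastOr b B < lastOr a A → wF (suc f) (st ((a ∷ A) ++ b ∷ B)) ≡ countLess b (a ∷ A) ∸ 1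
wF-st-twoRuns-endsHigher f a A b [] _ _ ascent _ b<lastA = ⊥-elim (<-asym b<lastA ascent)
wF-st-twoRuns-endsHigher f a A b (c ∷ cs) decA decB ascent uniq lastB<lastA with ∷-init-lastOr c cs
... | cs₀ , c∷cs≡ = wF-st-resolve f u (wF-st-unfold f) value (inj₂ (twoRuns-nontrivial a A b c cs decA decB ascent))
  where
  u : List ℕ
  u = (a ∷ A) ++ b ∷ c ∷ cs
  lastB : ℕ
  lastB = lastOr c cs
  X : List ℕ
  X = (a ∷ A) ++ b ∷ cs₀
  u≡ : u ≡ X ++ lastB ∷ []
  u≡ = trans (cong (λ l → (a ∷ A) ++ b ∷ l) c∷cs≡) (sym (++-assoc (a ∷ A) (b ∷ cs₀) (lastB ∷ [])))
  dec-b∷cs₀ : Decreasing ((b ∷ cs₀) ++ lastB ∷ [])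
  dec-b∷cs₀ = subst (λ l → Decreasing (b ∷ l)) c∷cs≡ decB
  lastB<X : All (lastB <_) X
  lastB<X = ++⁺ (All.map (<-≤-trans lastB<lastA) (lastOr-Decreasing a A decA))
            (Linked-∷ʳ⇒All >-trans (b ∷ cs₀) dec-b∷cs₀)
  open MinimumSplit u X lastB [] u≡ lastB<X []
  uniqX : Unique (map s X)
  uniqX = Unique-map s-orderPreservingˣ (Unique-++⁻ˡ X (subst Unique u≡ uniq))
  bA⊆X : b ∷ a ∷ A ⊆ X
  bA⊆X (here refl) = ∈-++⁺ʳ (a ∷ A) (here refl)
  bA⊆X (there z∈) = ∈-++⁺ˡ z∈
  pieces-X : piecesWeight f (map s X) ≡ countLess b (a ∷ A) ∸ 1
  pieces-X = begin
    piecesWeight f (map s X)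
      ≡⟨ cong (piecesWeight f) (map-++ s (a ∷ A) (b ∷ cs₀)) ⟩
    piecesWeight f (map s (a ∷ A) ++ s b ∷ map s cs₀)
      ≡⟨ piecesWeightF-Decreasing-++-Decreasing f _ (map s (a ∷ A)) (s b) (map s cs₀)
           (Decreasing-map (OrderPreservingOn-⊆ ∈-++⁺ˡ s-orderPreservingˣ) decA)
           (Decreasing-map (OrderPreservingOn-⊆ (∈-++⁺ʳ (a ∷ A)) s-orderPreservingˣ) (Linked-++⁻ˡ (b ∷ cs₀) dec-b∷cs₀))
           (subst Unique (map-++ s (a ∷ A) (b ∷ cs₀)) uniqX) ≤-refl ⟩
    countLess (s b) (map s (a ∷ A)) ∸ 1
      ≡⟨ cong (_∸ 1) (countLess-map b (a ∷ A) (OrderPreservingOn-⊆ bA⊆X s-orderPreservingˣ)) ⟩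
    countLess b (a ∷ A) ∸ 1 ∎
    where open ≡-Reasoning
  value : wF f (st Y⁺) + des Y⁺ + piecesWeight f (map s X) ≡ countLess b (a ∷ A) ∸ 1
  value rewrite st-[ M ] | wF-[1] f = pieces-X

wF-st-oneAscent : ∀ f u → Unique u → asc u ≡ 1 → wF (suc f) (st u) ≡ oneAscentWeight (descentRun u)
wF-st-oneAscent f u uniq asc≡1 with asc≡1⇒TwoRuns u uniq asc≡1
... | twoRuns a A b B refl decA decB ascent rewrite descentRun-twoRuns a A b B decA ascent
  with lastOr a A <ᵇ lastOr b B in lastA<ᵇlastB
... | true = wF-st-twoRuns-endsLower f a A b B decA decB ascent (<ᵇ≡true⇒< lastA<ᵇlastB)
... | false = wF-st-twoRuns-endsHigher f a A b B decA decB ascent uniq (≤∧≢⇒< (<ᵇ≡false⇒≥ lastA<ᵇlastB) lastB≢lastA)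
  where
  lastB≢lastA : lastOr b B ≢ lastOr a A
  lastB≢lastA e = Unique-++⇒disjoint (a ∷ A) uniq (lastOr-∈ a A) (lastOr-∈ b B) (sym e)

-- Counting over insertions of a new maximum

count : {A : Set} → (A → Bool) → List A → ℕ
count p xs = sum (map (χ ∘ p) xs)

module _ {A : Set} where

  sum-map-cong-∈ : ∀ {g h : A → ℕ} as → (∀ {a} → a ∈ as → g a ≡ h a) → sum (map g as) ≡ sum (map h as)
  sum-map-cong-∈ as g≡h = cong sum (map-cong-local (All.tabulate g≡h))

  count-cong-∈ : ∀ {p q : A → Bool} as → (∀ {a} → a ∈ as → p a ≡ q a) → count p as ≡ count q as
  count-cong-∈ as p≡q = sum-map-cong-∈ as (cong χ ∘ p≡q)

  count-cong : ∀ {p q : A → Bool} as → (∀ a → p a ≡ q a) → count p as ≡ count q as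
  count-cong as p≡q = count-cong-∈ as (λ {a} _ → p≡q a)

  count≡0 : ∀ {p : A → Bool} as → (∀ {a} → a ∈ as → p a ≡ false) → count p as ≡ 0
  count≡0 [] _ = refl
  count≡0 (a ∷ as) p≡false rewrite p≡false (here refl) = count≡0 as (p≡false ∘ there)

  count-map : ∀ {B : Set} (p : B → Bool) (g : A → B) as → count p (map g as) ≡ count (p ∘ g) as
  count-map p g as = cong sum (sym (map-∘ as))

  count-∧ʳ : ∀ (p : A → Bool) c as → count (λ a → p a ∧ c) as ≡ χ c * count p as
  count-∧ʳ p true as = trans (count-cong as (λ a → ∧-identityʳ (p a))) (sym (+-identityʳ _))
  count-∧ʳ p false as = count≡0 as (λ {a} _ → ∧-zeroʳ (p a))

  count-concatMap : ∀ {B : Set} (p : B → Bool) (g : A → List B) as →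
    count p (concatMap g as) ≡ sum (map (count p ∘ g) as)
  count-concatMap p g [] = refl
  count-concatMap p g (a ∷ as) = trans (cong sum (map-++ (χ ∘ p) (g a) (concatMap g as)))
    (trans (sum-++ (map (χ ∘ p) (g a)) (map (χ ∘ p) (concatMap g as))) (cong (count p (g a) +_) (count-concatMap p g as)))

  sum-map-+ : ∀ (g h : A → ℕ) as → sum (map (λ a → g a + h a) as) ≡ sum (map g as) + sum (map h as)
  sum-map-+ g h [] = refl
  sum-map-+ g h (a ∷ as) rewrite sum-map-+ g h as = interchange (g a) (h a) (sum (map g as)) (sum (map h as))

  sum-map-* : ∀ c (g : A → ℕ) as → sum (map (λ a → c * g a) as) ≡ c * sum (map g as)
  sum-map-* c g [] = sym (*-zeroʳ c)
  sum-map-* c g (a ∷ as) rewrite sum-map-* c g as = sym (*-distribˡ-+ c (g a) (sum (map g as)))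

length-filter≡count : ∀ {A : Set} {P : A → Set} (P? : Decidable P) xs → length (filter P? xs) ≡ count (λ x → does (P? x)) xs
length-filter≡count P? [] = refl
length-filter≡count P? (x ∷ xs) with does (P? x)
... | true = cong suc (length-filter≡count P? xs)
... | false = length-filter≡count P? xs

∈-insertions⁻ : ∀ {N τ} σ → τ ∈ insertions N σ → ∃[ P ] ∃[ S ] (σ ≡ P ++ S) × (τ ≡ P ++ N ∷ S)
∈-insertions⁻ [] (here refl) = [] , [] , refl , refl
∈-insertions⁻ (y ∷ ys) (here refl) = [] , y ∷ ys , refl , refl
∈-insertions⁻ (y ∷ ys) (there τ∈) with ∈-map⁻ (y ∷_) τ∈
... | τ′ , τ′∈ , refl with ∈-insertions⁻ ys τ′∈
...   | P , S , refl , refl = y ∷ P , S , refl , refl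

All-insertions : ∀ {Q : ℕ → Set} {N τ} σ → Q N → All Q σ → τ ∈ insertions N σ → All Q τ
All-insertions σ qN qσ τ∈ with ∈-insertions⁻ σ τ∈
... | P , S , refl , refl = ++⁺ (++⁻ˡ P qσ) (qN ∷ ++⁻ʳ P qσ)

count-insertions≡0 : ∀ (stat : List ℕ → ℕ) → (∀ {N} P S → All (_< N) (P ++ S) → stat (P ++ S) ≤ stat (P ++ N ∷ S)) →
  ∀ {N σ j} (p : List ℕ → Bool) → (∀ τ → j < stat τ → p τ ≡ false) → All (_< N) σ → j < stat σ →
  count p (insertions N σ) ≡ 0
count-insertions≡0 stat monotone {N} {σ} {j} p p-false σ<N j<stat = count≡0 (insertions N σ) λ {τ} τ∈ → p-false τ (j<stat-τ τ∈)
  where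
  j<stat-τ : ∀ {τ} → τ ∈ insertions N σ → j < stat τ
  j<stat-τ τ∈ with ∈-insertions⁻ σ τ∈
  ... | P , S , refl , refl = <-≤-trans j<stat (monotone P S σ<N)

≡ᵇ-∧-false : ∀ {j d} b → j < d → ((d ≡ᵇ j) ∧ b) ≡ false
≡ᵇ-∧-false b j<d rewrite ≢⇒≡ᵇ≡false (>⇒≢ j<d) = refl

record PermOf (n : ℕ) (π : List ℕ) : Set where
  field
    unique : Unique π
    length≡ : length π ≡ n
    bounded : All (_≤ n) π
    standard : All (λ x → rank π x ≡ x) π
open PermOf

∈-concatMap⁻ : ∀ {A B : Set} {b} (g : A → List B) as → b ∈ concatMap g as → ∃[ a ] a ∈ as × b ∈ g a
∈-concatMap⁻ g (a ∷ as) b∈ with ∈-++⁻ (g a) b∈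
... | inj₁ b∈ga = a , here refl , b∈ga
... | inj₂ b∈rest with ∈-concatMap⁻ g as b∈rest
...   | a′ , a′∈ , b∈ga′ = a′ , there a′∈ , b∈ga′

perms-PermOf : ∀ n {π} → π ∈ perms n → PermOf n π
perms-PermOf zero (here refl) = record { unique = [] ; length≡ = refl ; bounded = [] ; standard = [] }
perms-PermOf (suc n) π∈ with ∈-concatMap⁻ (insertions (suc n)) (perms n) π∈
... | σ , σ∈ , π∈ins with perms-PermOf n σ∈ | ∈-insertions⁻ σ π∈ins
...   | σ-perm | P , S , refl , refl = record
  { unique = Unique-insert P (All<⇒∉ σ<N) (unique σ-perm)
  ; length≡ = trans (length-++ P) (trans (+-suc (length P) (length S)) (cong suc (trans (sym (length-++ P)) (length≡ σ-perm))))
  ; bounded = ++⁺ (++⁻ˡ P σ≤N) (≤-refl ∷ ++⁻ʳ P σ≤N)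
  ; standard = ++⁺ (++⁻ˡ P σ-std) (rank-N ∷ ++⁻ʳ P σ-std)
  }
  where
  N : ℕ
  N = suc n
  σ<N : All (_< N) (P ++ S)
  σ<N = All.map s≤s (bounded σ-perm)
  σ≤N : All (_≤ N) (P ++ S)
  σ≤N = All.map m≤n⇒m≤1+n (bounded σ-perm)
  rank-N : rank (P ++ N ∷ S) N ≡ N
  rank-N rewrite countLess-insert N N P S | ≥⇒<ᵇ≡false {N} {N} ≤-refl | countLess-≡length σ<N = cong suc (length≡ σ-perm)
  σ-std : All (λ x → rank (P ++ N ∷ S) x ≡ x) (P ++ S)
  σ-std = All.tabulate λ {x} x∈ → trans (cong suc (trans (countLess-insert x N P S)
                                   (cong (_+ countLess x (P ++ S)) (cong χ (≥⇒<ᵇ≡false (m≤n⇒m≤1+n (All.lookup (bounded σ-perm) x∈)))))))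
                                   (All.lookup (standard σ-perm) x∈)

st-PermOf : PermOf n xs → st xs ≡ xs
st-PermOf π-perm = map-id-local (standard π-perm)

PermOf⇒All< : PermOf n xs → All (_< suc n) xs
PermOf⇒All< π-perm = All.map s≤s (bounded π-perm)

count-perms-suc : ∀ n (p q : List ℕ → Bool) c (g : List ℕ → ℕ) → count q (perms n) ≡ 1 →
  (∀ {σ} → PermOf n σ → count p (insertions (suc n) σ) ≡ c * χ (q σ) + g σ) →
  count p (perms (suc n)) ≡ c + sum (map g (perms n))
count-perms-suc n p q c g count-q≡1 per-σ = begin
  count p (perms (suc n))
    ≡⟨ count-concatMap p (insertions (suc n)) (perms n) ⟩
  sum (map (λ σ → count p (insertions (suc n) σ)) (perms n))
    ≡⟨ sum-map-cong-∈ (perms n) (per-σ ∘ perms-PermOf n) ⟩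
  sum (map (λ σ → c * χ (q σ) + g σ) (perms n))
    ≡⟨ sum-map-+ (λ σ → c * χ (q σ)) g (perms n) ⟩
  sum (map (λ σ → c * χ (q σ)) (perms n)) + sum (map g (perms n))
    ≡⟨ cong (_+ sum (map g (perms n))) (trans (sum-map-* c (χ ∘ q) (perms n)) (cong (c *_) count-q≡1)) ⟩
  c * 1 + sum (map g (perms n))
    ≡⟨ cong (_+ sum (map g (perms n))) (*-identityʳ c) ⟩
  c + sum (map g (perms n)) ∎
  where open ≡-Reasoning

count-perms≡1 : ∀ (q : List ℕ → Bool) → q [] ≡ true →
  (∀ {n σ} → PermOf n σ → count q (insertions (suc n) σ) ≡ χ (q σ)) → ∀ n → count q (perms n) ≡ 1
count-perms≡1 q q[] per-σ zero rewrite q[] = refl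
count-perms≡1 q q[] per-σ (suc n) =
  trans (count-perms-suc n q q 1 (λ _ → 0) (count-perms≡1 q q[] per-σ n) (λ σ-perm → trans (per-σ σ-perm) (sym (trans (+-identityʳ _) (*-identityˡ _)))))
        (cong suc (count≡0 {p = λ _ → false} (perms n) (λ _ → refl)))

-- Permutations with one descent

descentFree : List ℕ → Bool
descentFree τ = des τ ≡ᵇ 0

oneDescent : (ℕ → Bool) → List ℕ → Bool
oneDescent R τ = (des τ ≡ᵇ 1) ∧ R (leadingMinima τ)

count-descentFree-insertions-Increasing : ∀ N σ → Increasing σ → All (_< N) σ → count descentFree (insertions N σ) ≡ 1
count-descentFree-insertions-Increasing N [] _ _ = refl
count-descentFree-insertions-Increasing N (y ∷ ys) inc (y<N ∷ ys<N) = begin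
  χ (descentFree (N ∷ y ∷ ys)) + count descentFree (map (y ∷_) (insertions N ys))
    ≡⟨ cong₂ (λ d r → χ (d ≡ᵇ 0) + r) des-Nyys (count-map descentFree (y ∷_) (insertions N ys)) ⟩
  count (descentFree ∘ (y ∷_)) (insertions N ys)
    ≡⟨ count-cong-∈ (insertions N ys) (λ τ∈ → cong (_≡ᵇ 0) (des-∷-min (y≤τ τ∈))) ⟩
  count descentFree (insertions N ys)
    ≡⟨ count-descentFree-insertions-Increasing N ys (Linked.tail inc) ys<N ⟩
  1 ∎
  where
  open ≡-Reasoning
  des-Nyys : des (N ∷ y ∷ ys) ≡ 1
  des-Nyys rewrite <⇒<ᵇ≡true y<N | des-Increasing inc = refl
  y≤τ : ∀ {τ} → τ ∈ insertions N ys → All (y ≤_) τ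
  y≤τ = All-insertions ys (<⇒≤ y<N) (All.map <⇒≤ (Increasing⇒All inc))

count-oneDescent-insertions-Increasing : ∀ N σ m → Increasing σ → All (_< N) σ →
  count (oneDescent (_≡ᵇ m)) (insertions N σ) ≡ χ (m <ᵇ length σ)
count-oneDescent-insertions-Increasing N [] m _ _ = refl
count-oneDescent-insertions-Increasing N (y ∷ ys) m inc (y<N ∷ ys<N) = begin
  χ (oneDescent (_≡ᵇ m) (N ∷ y ∷ ys)) + count (oneDescent (_≡ᵇ m)) (map (y ∷_) (insertions N ys))
    ≡⟨ cong₂ _+_ first (count-map (oneDescent (_≡ᵇ m)) (y ∷_) (insertions N ys)) ⟩
  χ (0 ≡ᵇ m) + count (oneDescent (_≡ᵇ m) ∘ (y ∷_)) (insertions N ys)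
    ≡⟨ cong (χ (0 ≡ᵇ m) +_) (count-cong-∈ (insertions N ys) shift) ⟩
  χ (0 ≡ᵇ m) + count (oneDescent (λ k → suc k ≡ᵇ m)) (insertions N ys)
    ≡⟨ by-m m ⟩
  χ (m <ᵇ suc (length ys)) ∎
  where
  open ≡-Reasoning
  first : χ (oneDescent (_≡ᵇ m) (N ∷ y ∷ ys)) ≡ χ (0 ≡ᵇ m)
  first rewrite <⇒<ᵇ≡true y<N | des-Increasing inc | ≥⇒<ᵇ≡false {N} {y} (<⇒≤ y<N) = refl
  y<τ : ∀ {τ} → τ ∈ insertions N ys → All (y <_) τ
  y<τ = All-insertions ys y<N (Increasing⇒All inc)
  shift : ∀ {τ} → τ ∈ insertions N ys → oneDescent (_≡ᵇ m) (y ∷ τ) ≡ oneDescent (λ k → suc k ≡ᵇ m) τ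
  shift τ∈ rewrite des-∷-min (All.map <⇒≤ (y<τ τ∈)) | all-<ᵇ≡true (y<τ τ∈) = refl
  by-m : ∀ m → χ (0 ≡ᵇ m) + count (oneDescent (λ k → suc k ≡ᵇ m)) (insertions N ys) ≡ χ (m <ᵇ suc (length ys))
  by-m zero = cong suc (count≡0 (insertions N ys) (λ {τ} _ → ∧-zeroʳ (des τ ≡ᵇ 1)))
  by-m (suc m) = count-oneDescent-insertions-Increasing N ys m (Linked.tail inc) ys<N

all-<ᵇ-insert : ∀ P S → y < n → all (y <ᵇ_) (P ++ n ∷ S) ≡ all (y <ᵇ_) (P ++ S)
all-<ᵇ-insert [] S y<n rewrite <⇒<ᵇ≡true y<n = refl
all-<ᵇ-insert {y} (x ∷ P) S y<n = cong ((y <ᵇ x) ∧_) (all-<ᵇ-insert P S y<n)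

count-oneDescent-insertions-descentFirst : ∀ N y h hs R → h < y → Increasing (h ∷ hs) → All (_< N) (y ∷ h ∷ hs) →
  count (oneDescent R) (insertions N (y ∷ h ∷ hs)) ≡ 2 * χ (R 0)
count-oneDescent-insertions-descentFirst N y h hs R h<y inc (y<N ∷ h<N ∷ hs<N) = begin
  χ (oneDescent R (N ∷ y ∷ h ∷ hs)) + (χ (oneDescent R (y ∷ N ∷ h ∷ hs)) + count (oneDescent R) later)
    ≡⟨ cong₂ (λ a b → a + (b + count (oneDescent R) later)) first second ⟩
  χ (R 0) + count (oneDescent R) later
    ≡⟨ cong (χ (R 0) +_) rest ⟩
  χ (R 0) + χ (R 0) * 1
    ≡⟨ cong (χ (R 0) +_) (trans (*-identityʳ (χ (R 0))) (sym (*-identityˡ (χ (R 0))))) ⟩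
  2 * χ (R 0) ∎
  where
  open ≡-Reasoning
  later = map (y ∷_) (map (h ∷_) (insertions N hs))
  first : χ (oneDescent R (N ∷ y ∷ h ∷ hs)) ≡ 0
  first rewrite <⇒<ᵇ≡true y<N | <⇒<ᵇ≡true h<y = refl
  second : χ (oneDescent R (y ∷ N ∷ h ∷ hs)) ≡ χ (R 0)
  second rewrite ≥⇒<ᵇ≡false {N} {y} (<⇒≤ y<N) | <⇒<ᵇ≡true h<N | des-Increasing inc
               | <⇒<ᵇ≡true y<N | ≥⇒<ᵇ≡false {y} {h} (<⇒≤ h<y) = refl
  N∷h∷hs-hasDescent : χ (descentFree (N ∷ h ∷ hs)) ≡ 0
  N∷h∷hs-hasDescent rewrite <⇒<ᵇ≡true h<N = refl
  descentFree-later : count (descentFree ∘ (h ∷_)) (insertions N hs) ≡ 1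
  descentFree-later = begin
    count (descentFree ∘ (h ∷_)) (insertions N hs)
      ≡⟨ sym (count-map descentFree (h ∷_) (insertions N hs)) ⟩
    count descentFree (map (h ∷_) (insertions N hs))
      ≡⟨ cong (_+ count descentFree (map (h ∷_) (insertions N hs))) (sym N∷h∷hs-hasDescent) ⟩
    χ (descentFree (N ∷ h ∷ hs)) + count descentFree (map (h ∷_) (insertions N hs))
      ≡⟨ count-descentFree-insertions-Increasing N (h ∷ hs) inc (h<N ∷ hs<N) ⟩
    1 ∎
  starts-with-descent : ∀ τ → oneDescent R (y ∷ h ∷ τ) ≡ descentFree (h ∷ τ) ∧ R 0
  starts-with-descent τ rewrite <⇒<ᵇ≡true h<y | ≥⇒<ᵇ≡false {y} {h} (<⇒≤ h<y) = refl
  rest : count (oneDescent R) later ≡ χ (R 0) * 1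
  rest = begin
    count (oneDescent R) later
      ≡⟨ trans (count-map (oneDescent R) (y ∷_) (map (h ∷_) (insertions N hs))) (count-map (oneDescent R ∘ (y ∷_)) (h ∷_) (insertions N hs)) ⟩
    count (λ τ → oneDescent R (y ∷ h ∷ τ)) (insertions N hs)
      ≡⟨ count-cong (insertions N hs) starts-with-descent ⟩
    count (λ τ → descentFree (h ∷ τ) ∧ R 0) (insertions N hs)
      ≡⟨ count-∧ʳ (descentFree ∘ (h ∷_)) (R 0) (insertions N hs) ⟩
    χ (R 0) * count (descentFree ∘ (h ∷_)) (insertions N hs)
      ≡⟨ cong (χ (R 0) *_) descentFree-later ⟩
    χ (R 0) * 1 ∎

count-oneDescent-insertions-oneDescent : ∀ N σ R → Unique σ → All (_< N) σ → des σ ≡ 1 →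
  count (oneDescent R) (insertions N σ) ≡ 2 * χ (R (leadingMinima σ))
count-oneDescent-insertions-oneDescent N (y ∷ h ∷ hs) R u@(_ ∷ u′) σ<N@(y<N ∷ hhs<N@(h<N ∷ _)) des≡1
  with h <? y
... | yes h<y = trans
  (count-oneDescent-insertions-descentFirst N y h hs R h<y (des≡0⇒Increasing u′ (suc-injective des≡1′)) σ<N)
  (cong (λ k → 2 * χ (R k)) (sym leadingMinima≡0))
  where
  des≡1′ : suc (des (h ∷ hs)) ≡ 1
  des≡1′ = trans (cong (λ b → χ b + des (h ∷ hs)) (sym (<⇒<ᵇ≡true h<y))) des≡1
  leadingMinima≡0 : leadingMinima (y ∷ h ∷ hs) ≡ 0
  leadingMinima≡0 rewrite ≥⇒<ᵇ≡false {y} {h} (<⇒≤ h<y) = refl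
... | no h≮y = begin
  χ (oneDescent R (N ∷ y ∷ h ∷ hs)) + count (oneDescent R) (map (y ∷_) (insertions N (h ∷ hs)))
    ≡⟨ cong₂ _+_ first (count-map (oneDescent R) (y ∷_) (insertions N (h ∷ hs))) ⟩
  count (oneDescent R ∘ (y ∷_)) (insertions N (h ∷ hs))
    ≡⟨ count-cong-∈ (insertions N (h ∷ hs)) shift ⟩
  count (oneDescent R′) (insertions N (h ∷ hs))
    ≡⟨ count-oneDescent-insertions-oneDescent N (h ∷ hs) R′ u′ hhs<N des-h∷hs ⟩
  2 * χ (R′ (leadingMinima (h ∷ hs))) ∎
  where
  open ≡-Reasoning
  h<ᵇy : (h <ᵇ y) ≡ false
  h<ᵇy = ≥⇒<ᵇ≡false (≮⇒≥ h≮y)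
  des-h∷hs : des (h ∷ hs) ≡ 1
  des-h∷hs = trans (cong (λ b → χ b + des (h ∷ hs)) (sym h<ᵇy)) des≡1
  R′ : ℕ → Bool
  R′ k = R (if all (y <ᵇ_) (h ∷ hs) then suc k else 0)
  first : χ (oneDescent R (N ∷ y ∷ h ∷ hs)) ≡ 0
  first rewrite <⇒<ᵇ≡true y<N | h<ᵇy | des≡1 = refl
  shift : ∀ {τ} → τ ∈ insertions N (h ∷ hs) → oneDescent R (y ∷ τ) ≡ oneDescent R′ τ
  shift τ∈ with ∈-insertions⁻ (h ∷ hs) τ∈
  ... | [] , _ , refl , refl rewrite ≥⇒<ᵇ≡false {N} {y} (<⇒≤ y<N) | all-<ᵇ-insert [] (h ∷ hs) y<N = refl
  ... | _ ∷ P , S , refl , refl rewrite h<ᵇy | all-<ᵇ-insert (h ∷ P) S y<N = refl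

count-descentFree-insertions : ∀ N σ → Unique σ → All (_< N) σ → count descentFree (insertions N σ) ≡ χ (descentFree σ)
count-descentFree-insertions N σ u σ<N with des σ in des≡
... | zero = count-descentFree-insertions-Increasing N σ (des≡0⇒Increasing u des≡) σ<N
... | suc _ = count-insertions≡0 des des-insert-max descentFree (λ τ 0<des → ≢⇒≡ᵇ≡false (>⇒≢ 0<des)) σ<N
                                  (subst (0 <_) (sym des≡) (s≤s z≤n))

count-descentFree-perms : ∀ n → count descentFree (perms n) ≡ 1
count-descentFree-perms = count-perms≡1 descentFree refl
  (λ {n} {σ} σ-perm → count-descentFree-insertions (suc n) σ (unique σ-perm) (PermOf⇒All< σ-perm))

count-oneDescent-perms-suc : ∀ n m →
  count (oneDescent (_≡ᵇ m)) (perms (suc n)) ≡ χ (m <ᵇ n) + 2 * count (oneDescent (_≡ᵇ m)) (perms n)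
count-oneDescent-perms-suc n m =
  trans (count-perms-suc n (oneDescent (_≡ᵇ m)) descentFree (χ (m <ᵇ n)) (λ σ → 2 * χ (oneDescent (_≡ᵇ m) σ))
                         (count-descentFree-perms n) per-σ)
        (cong (χ (m <ᵇ n) +_) (sum-map-* 2 (χ ∘ oneDescent (_≡ᵇ m)) (perms n)))
  where
  per-σ : ∀ {σ} → PermOf n σ → count (oneDescent (_≡ᵇ m)) (insertions (suc n) σ) ≡
                               χ (m <ᵇ n) * χ (descentFree σ) + 2 * χ (oneDescent (_≡ᵇ m) σ)
  per-σ {σ} σ-perm with des σ in des≡
  ... | zero = begin
    count (oneDescent (_≡ᵇ m)) (insertions (suc n) σ)
      ≡⟨ count-oneDescent-insertions-Increasing (suc n) σ m (des≡0⇒Increasing (unique σ-perm) des≡) (PermOf⇒All< σ-perm) ⟩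
    χ (m <ᵇ length σ)
      ≡⟨ cong (λ k → χ (m <ᵇ k)) (length≡ σ-perm) ⟩
    χ (m <ᵇ n)
      ≡⟨ sym (trans (+-identityʳ _) (*-identityʳ _)) ⟩
    χ (m <ᵇ n) * 1 + 0 ∎
    where open ≡-Reasoning
  ... | suc zero = trans (count-oneDescent-insertions-oneDescent (suc n) σ (_≡ᵇ m) (unique σ-perm) (PermOf⇒All< σ-perm) des≡)
                         (cong (_+ 2 * χ (leadingMinima σ ≡ᵇ m)) (sym (*-zeroʳ (χ (m <ᵇ n)))))
  ... | suc (suc _) = trans (count-insertions≡0 des des-insert-max (oneDescent (_≡ᵇ m)) (λ τ → ≡ᵇ-∧-false _) (PermOf⇒All< σ-perm)
                                                 (subst (1 <_) (sym des≡) (s≤s (s≤s z≤n))))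
                            (sym (trans (+-identityʳ _) (*-zeroʳ (χ (m <ᵇ n)))))

mersenne-step : ∀ n m → χ (m <ᵇ n) + 2 * (2 ^ (n ∸ 1 ∸ m) ∸ 1) ≡ 2 ^ (n ∸ m) ∸ 1
mersenne-step zero m rewrite 0∸n≡0 m = refl
mersenne-step (suc n) zero = 1+2*[x∸1]≡2*x∸1 (2 ^ n) (m^n>0 2 n)
  where
  1+2*[x∸1]≡2*x∸1 : ∀ x → 1 ≤ x → 1 + 2 * (x ∸ 1) ≡ 2 * x ∸ 1
  1+2*[x∸1]≡2*x∸1 (suc x) _ = sym (+-suc x (x + 0))
mersenne-step (suc n) (suc m) =
  trans (cong (λ k → χ (m <ᵇ n) + 2 * (2 ^ k ∸ 1)) (sym (∸-+-assoc n 1 m))) (mersenne-step n m)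

count-oneDescent-perms : ∀ n m → count (oneDescent (_≡ᵇ m)) (perms n) ≡ 2 ^ (n ∸ 1 ∸ m) ∸ 1
count-oneDescent-perms zero m rewrite 0∸n≡0 m = refl
count-oneDescent-perms (suc n) m = begin
  count (oneDescent (_≡ᵇ m)) (perms (suc n))                ≡⟨ count-oneDescent-perms-suc n m ⟩
  χ (m <ᵇ n) + 2 * count (oneDescent (_≡ᵇ m)) (perms n)      ≡⟨ cong (λ k → χ (m <ᵇ n) + 2 * k) (count-oneDescent-perms n m) ⟩
  χ (m <ᵇ n) + 2 * (2 ^ (n ∸ 1 ∸ m) ∸ 1)                     ≡⟨ mersenne-step n m ⟩
  2 ^ (n ∸ m) ∸ 1                                           ∎
  where open ≡-Reasoning

-- Permutations with one ascent

ascentFree oneAscent : List ℕ → Bool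
ascentFree τ = asc τ ≡ᵇ 0
oneAscent τ = asc τ ≡ᵇ 1

Decreasing-insert-after-head : ∀ N y P S → Decreasing (y ∷ P ++ S) → All (_< N) (y ∷ P ++ S) →
  descentRun ((y ∷ P) ++ N ∷ S) ≡ (y ∷ P , N ∷ S) × asc ((y ∷ P) ++ N ∷ S) ≡ 1
Decreasing-insert-after-head N y P S dec σ<N =
  descentRun-twoRuns y P N S decP last<N , asc-twoRuns y P N S decP decNS last<N
  where
  decP : Decreasing (y ∷ P)
  decP = Linked-++⁻ˡ (y ∷ P) dec
  last<N : lastOr y P < N
  last<N = All.lookup σ<N (∈-++⁺ˡ (lastOr-∈ y P))
  decNS : Decreasing (N ∷ S)
  decNS = Decreasing-∷ (++⁻ʳ (y ∷ P) σ<N) (Linked-++⁻ʳ (y ∷ P) dec)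

∈-laterInsertions⁻ : ∀ {N τ} y ys → τ ∈ map (y ∷_) (insertions N ys) → ∃[ P ] ∃[ S ] (ys ≡ P ++ S) × (τ ≡ (y ∷ P) ++ N ∷ S)
∈-laterInsertions⁻ y ys τ∈ with ∈-map⁻ (y ∷_) τ∈
... | τ′ , τ′∈ , refl with ∈-insertions⁻ ys τ′∈
...   | P , S , refl , refl = P , S , refl , refl

oneAscent-laterInsertions-Decreasing : ∀ {N τ} y ys → Decreasing (y ∷ ys) → All (_< N) (y ∷ ys) →
  τ ∈ map (y ∷_) (insertions N ys) → asc τ ≡ 1
oneAscent-laterInsertions-Decreasing {N} y ys dec σ<N τ∈ with ∈-laterInsertions⁻ y ys τ∈
... | P , S , refl , refl = proj₂ (Decreasing-insert-after-head N y P S dec σ<N)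

asc-front-Decreasing : ∀ N y ys → Decreasing (y ∷ ys) → y < N → asc (N ∷ y ∷ ys) ≡ 0
asc-front-Decreasing N y ys dec y<N rewrite ≥⇒<ᵇ≡false {N} {y} (<⇒≤ y<N) = asc-Decreasing dec

count-oneAscent-insertions-Decreasing : ∀ N y ys (R : List ℕ → Bool) → Decreasing (y ∷ ys) → All (_< N) (y ∷ ys) →
  count (λ τ → oneAscent τ ∧ R τ) (insertions N (y ∷ ys)) ≡ count R (map (y ∷_) (insertions N ys))
count-oneAscent-insertions-Decreasing N y ys R dec σ<N = cong₂ _+_ front (count-cong-∈ (map (y ∷_) (insertions N ys)) later)
  where
  front : χ (oneAscent (N ∷ y ∷ ys) ∧ R (N ∷ y ∷ ys)) ≡ 0
  front rewrite asc-front-Decreasing N y ys dec (All.head σ<N) = refl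
  later : ∀ {τ} → τ ∈ map (y ∷_) (insertions N ys) → (oneAscent τ ∧ R τ) ≡ R τ
  later τ∈ rewrite oneAscent-laterInsertions-Decreasing y ys dec σ<N τ∈ = refl

count-ascentFree-insertions-Decreasing : ∀ N σ → Decreasing σ → All (_< N) σ → count ascentFree (insertions N σ) ≡ 1
count-ascentFree-insertions-Decreasing N [] _ _ = refl
count-ascentFree-insertions-Decreasing N (y ∷ ys) dec σ<N = cong₂ _+_ front (count≡0 (map (y ∷_) (insertions N ys)) later)
  where
  front : χ (ascentFree (N ∷ y ∷ ys)) ≡ 1
  front rewrite asc-front-Decreasing N y ys dec (All.head σ<N) = refl
  later : ∀ {τ} → τ ∈ map (y ∷_) (insertions N ys) → ascentFree τ ≡ false
  later τ∈ rewrite oneAscent-laterInsertions-Decreasing y ys dec σ<N τ∈ = refl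

count-ascentFree-insertions : ∀ N σ → Unique σ → All (_< N) σ → count ascentFree (insertions N σ) ≡ χ (ascentFree σ)
count-ascentFree-insertions N σ u σ<N with asc σ in asc≡
... | zero = count-ascentFree-insertions-Decreasing N σ (asc≡0⇒Decreasing u asc≡) σ<N
... | suc _ = count-insertions≡0 asc asc-insert-max ascentFree (λ τ 0<asc → ≢⇒≡ᵇ≡false (>⇒≢ 0<asc)) σ<N
                                  (subst (0 <_) (sym asc≡) (s≤s z≤n))

count-ascentFree-perms : ∀ n → count ascentFree (perms n) ≡ 1
count-ascentFree-perms = count-perms≡1 ascentFree refl
  (λ {n} {σ} σ-perm → count-ascentFree-insertions (suc n) σ (unique σ-perm) (PermOf⇒All< σ-perm))

1≤asc-∷ : ∀ x ys → x < y → y ∈ ys → 1 ≤ asc (x ∷ ys)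
1≤asc-∷ x (z ∷ ys) x<y y∈ with x <ᵇ z in x<ᵇz
... | true = s≤s z≤n
... | false with y∈
...   | here refl = ⊥-elim (<⇒≱ x<y (<ᵇ≡false⇒≥ x<ᵇz))
...   | there y∈ys = 1≤asc-∷ z ys (≤-<-trans (<ᵇ≡false⇒≥ x<ᵇz) x<y) y∈ys

count-oneAscent-laterInsertions-twoRuns : ∀ N a A b B (R : List ℕ → Bool) → Decreasing (a ∷ A) → Decreasing (b ∷ B) →
  lastOr a A < b → All (_< N) ((a ∷ A) ++ b ∷ B) →
  count (λ τ → oneAscent τ ∧ R τ) (map (a ∷_) (insertions N (A ++ b ∷ B))) ≡ χ (R ((a ∷ A) ++ N ∷ b ∷ B))
count-oneAscent-laterInsertions-twoRuns N a [] b B R _ decB a<b (a<N ∷ b<N ∷ _) =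
  trans (cong₂ _+_ first (count≡0 (map (a ∷_) (map (b ∷_) (insertions N B))) two-ascents)) (+-identityʳ _)
  where
  first : χ (oneAscent (a ∷ N ∷ b ∷ B) ∧ R (a ∷ N ∷ b ∷ B)) ≡ χ (R (a ∷ N ∷ b ∷ B))
  first rewrite <⇒<ᵇ≡true a<N | ≥⇒<ᵇ≡false {N} {b} (<⇒≤ b<N) | asc-Decreasing decB = refl
  two-ascents : ∀ {τ} → τ ∈ map (a ∷_) (map (b ∷_) (insertions N B)) → (oneAscent τ ∧ R τ) ≡ false
  two-ascents τ∈ with ∈-map⁻ (a ∷_) τ∈
  ... | _ , τ′∈ , refl with ∈-laterInsertions⁻ b B τ′∈
  ...   | P , S , refl , refl rewrite <⇒<ᵇ≡true a<b with asc (b ∷ P ++ N ∷ S) | 1≤asc-∷ b (P ++ N ∷ S) b<N (∈-++⁺ʳ P (here refl))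
  ...     | suc _ | _ = refl
count-oneAscent-laterInsertions-twoRuns N a (a′ ∷ A) b B R decA decB last<b (a<N ∷ σ<N@(a′<N ∷ _)) =
  cong₂ _+_ first (begin
    count (λ τ → oneAscent τ ∧ R τ) (map (a ∷_) (map (a′ ∷_) (insertions N (A ++ b ∷ B))))
      ≡⟨ count-map (λ τ → oneAscent τ ∧ R τ) (a ∷_) (map (a′ ∷_) (insertions N (A ++ b ∷ B))) ⟩
    count (λ τ → oneAscent (a ∷ τ) ∧ R (a ∷ τ)) (map (a′ ∷_) (insertions N (A ++ b ∷ B)))
      ≡⟨ count-cong-∈ (map (a′ ∷_) (insertions N (A ++ b ∷ B))) descent-first ⟩
    count (λ τ → oneAscent τ ∧ R (a ∷ τ)) (map (a′ ∷_) (insertions N (A ++ b ∷ B)))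
      ≡⟨ count-oneAscent-laterInsertions-twoRuns N a′ A b B (R ∘ (a ∷_)) (Linked.tail decA) decB last<b σ<N ⟩
    χ (R (a ∷ a′ ∷ A ++ N ∷ b ∷ B)) ∎)
  where
  open ≡-Reasoning
  first : χ (oneAscent (a ∷ N ∷ a′ ∷ A ++ b ∷ B) ∧ R (a ∷ N ∷ a′ ∷ A ++ b ∷ B)) ≡ 0
  first rewrite <⇒<ᵇ≡true a<N | ≥⇒<ᵇ≡false {N} {a′} (<⇒≤ a′<N) | asc-twoRuns a′ A b B (Linked.tail decA) decB last<b = refl
  descent-first : ∀ {τ} → τ ∈ map (a′ ∷_) (insertions N (A ++ b ∷ B)) → (oneAscent (a ∷ τ) ∧ R (a ∷ τ)) ≡ (oneAscent τ ∧ R (a ∷ τ))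
  descent-first τ∈ with ∈-map⁻ (a′ ∷_) τ∈
  ... | _ , _ , refl rewrite ≥⇒<ᵇ≡false {a} {a′} (<⇒≤ (Linked.head decA)) = refl

count-oneAscent-insertions-twoRuns : ∀ N a A b B (R : List ℕ → Bool) → Decreasing (a ∷ A) → Decreasing (b ∷ B) →
  lastOr a A < b → All (_< N) ((a ∷ A) ++ b ∷ B) →
  count (λ τ → oneAscent τ ∧ R τ) (insertions N ((a ∷ A) ++ b ∷ B)) ≡ χ (R (N ∷ (a ∷ A) ++ b ∷ B)) + χ (R ((a ∷ A) ++ N ∷ b ∷ B))
count-oneAscent-insertions-twoRuns N a A b B R decA decB ascent σ<N =
  cong₂ _+_ first (count-oneAscent-laterInsertions-twoRuns N a A b B R decA decB ascent σ<N)
  where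
  first : χ (oneAscent (N ∷ (a ∷ A) ++ b ∷ B) ∧ R (N ∷ (a ∷ A) ++ b ∷ B)) ≡ χ (R (N ∷ (a ∷ A) ++ b ∷ B))
  first rewrite ≥⇒<ᵇ≡false {N} {a} (<⇒≤ (All.head σ<N)) | asc-twoRuns a A b B decA decB ascent = refl

-- The weight alone does not follow a closed recurrence under insertion of the maximum; together
-- with the type (endsLower) and auxStat it does, see profile-front and profile-middle.
auxStat : List ℕ × List ℕ → ℕ
auxStat (A , B) = if endsLower (A , B) then length B else length A ∸ 1

Profile : Set
Profile = Bool × ℕ × ℕ

profile : List ℕ → Profile
profile τ = endsLower (descentRun τ) , auxStat (descentRun τ) , oneAscentWeight (descentRun τ)

shiftFront shiftMiddle : Profile → Profile
shiftFront (e , z , w) = e , (if e then z else suc z) , w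
shiftMiddle (e , z , w) = e , (if e then suc z else z) , (if e then suc w else z)

module _ (N a : ℕ) (A : List ℕ) (b : ℕ) (B : List ℕ) (decA : Decreasing (a ∷ A)) (decB : Decreasing (b ∷ B))
         (ascent : lastOr a A < b) (σ<N : All (_< N) ((a ∷ A) ++ b ∷ B)) where

  private
    a<N : a < N
    a<N = All.head σ<N
    b<N : b < N
    b<N = All.lookup σ<N (∈-++⁺ʳ (a ∷ A) (here refl))
    A<N : All (_< N) (a ∷ A)
    A<N = ++⁻ˡ (a ∷ A) σ<N

  profile-front : profile (N ∷ (a ∷ A) ++ b ∷ B) ≡ shiftFront (profile ((a ∷ A) ++ b ∷ B))
  profile-front rewrite descentRun-twoRuns N (a ∷ A) b B (a<N ∷ decA) ascent | descentRun-twoRuns a A b B decA ascent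
    with lastOr a A <ᵇ lastOr b B
  ... | true = refl
  ... | false rewrite ≥⇒<ᵇ≡false {N} {b} (<⇒≤ b<N) = refl

  profile-middle : profile ((a ∷ A) ++ N ∷ b ∷ B) ≡ shiftMiddle (profile ((a ∷ A) ++ b ∷ B))
  profile-middle rewrite descentRun-twoRuns a A N (b ∷ B) decA (All.lookup A<N (lastOr-∈ a A))
                       | descentRun-twoRuns a A b B decA ascent
    with lastOr a A <ᵇ lastOr b B
  ... | true = refl
  ... | false rewrite countLess-≡length A<N = refl

module _ (N y : ℕ) (P : List ℕ) where

  private
    lastOr-later : ∀ z zs → Decreasing ((y ∷ P) ++ z ∷ zs) → lastOr z zs < lastOr y P
    lastOr-later z zs dec = ≤-<-trans (All.head (lastOr-Decreasing z zs (Linked-++⁻ʳ (y ∷ P) dec)))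
                                      (Decreasing-++⇒< (y ∷ P) dec (lastOr-∈ y P) (here refl))

  profile-insert-last : Decreasing (y ∷ P) → All (_< N) (y ∷ P) → profile ((y ∷ P) ++ N ∷ []) ≡ (true , 1 , 0)
  profile-insert-last dec σ<N
    rewrite proj₁ (Decreasing-insert-after-head N y P [] (subst Decreasing (sym (++-identityʳ (y ∷ P))) dec)
                                                          (subst (All (_< N)) (sym (++-identityʳ (y ∷ P))) σ<N))
          | <⇒<ᵇ≡true (All.lookup σ<N (lastOr-∈ y P)) = refl

  profile-insert-inner : ∀ z zs → Decreasing ((y ∷ P) ++ z ∷ zs) → All (_< N) ((y ∷ P) ++ z ∷ zs) →
    profile ((y ∷ P) ++ N ∷ z ∷ zs) ≡ (false , length P , length P)
  profile-insert-inner z zs dec σ<N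
    rewrite proj₁ (Decreasing-insert-after-head N y P (z ∷ zs) dec σ<N)
          | ≥⇒<ᵇ≡false {lastOr y P} {lastOr z zs} (<⇒≤ (lastOr-later z zs dec))
          | countLess-≡length (++⁻ˡ (y ∷ P) σ<N) = refl

count-upTo-suc : ∀ (F : ℕ → Bool) k → count F (upTo (suc k)) ≡ χ (F 0) + count (F ∘ suc) (upTo k)
count-upTo-suc F k =
  cong (χ (F 0) +_) (cong sum (trans (map-applyUpTo suc (χ ∘ F) k) (sym (map-applyUpTo (λ j → j) (χ ∘ F ∘ suc) k))))

count-≡ᵇ-upTo : ∀ z k → count (_≡ᵇ z) (upTo k) ≡ χ (z <ᵇ k)
count-≡ᵇ-upTo z zero = refl
count-≡ᵇ-upTo zero (suc k) = trans (count-upTo-suc (_≡ᵇ 0) k) (cong suc (count≡0 (upTo k) (λ _ → refl)))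
count-≡ᵇ-upTo (suc z) (suc k) = trans (count-upTo-suc (_≡ᵇ suc z) k) (count-≡ᵇ-upTo z k)

-- Inserting the maximum after the first j + 1 letters of a decreasing word gives the profile
-- (false , j , j), except at the very end, where it gives (true , 1 , 0).
count-profile-insertions-Decreasing : ∀ N y P ys (R : Profile → Bool) → Decreasing ((y ∷ P) ++ ys) → All (_< N) ((y ∷ P) ++ ys) →
  count (R ∘ profile) (map ((y ∷ P) ++_) (insertions N ys)) ≡
    count (λ j → R (false , length P + j , length P + j)) (upTo (length ys)) + χ (R (true , 1 , 0))
count-profile-insertions-Decreasing N y P [] R dec σ<N =
  trans (cong (λ p → χ (R p) + 0) (profile-insert-last N y P (subst Decreasing (++-identityʳ (y ∷ P)) dec)
                                                              (subst (All (_< N)) (++-identityʳ (y ∷ P)) σ<N)))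
        (+-identityʳ _)
count-profile-insertions-Decreasing N y P (z ∷ zs) R dec σ<N = begin
  χ (R (profile ((y ∷ P) ++ N ∷ z ∷ zs))) + count (R ∘ profile) (map ((y ∷ P) ++_) (map (z ∷_) (insertions N zs)))
    ≡⟨ cong₂ _+_ (cong (χ ∘ R) (profile-insert-inner N y P z zs dec σ<N)) (cong (count (R ∘ profile)) regroup) ⟩
  χ (R (false , length P , length P)) + count (R ∘ profile) (map ((y ∷ P ++ z ∷ []) ++_) (insertions N zs))
    ≡⟨ cong (χ (R (false , length P , length P)) +_)
            (count-profile-insertions-Decreasing N y (P ++ z ∷ []) zs R (subst Decreasing reassoc dec) (subst (All (_< N)) reassoc σ<N)) ⟩
  χ (R (false , length P , length P)) + (count (F′ (length (P ++ z ∷ []))) (upTo (length zs)) + χ (R (true , 1 , 0)))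
    ≡⟨ sym (+-assoc (χ (R (false , length P , length P))) (count (F′ (length (P ++ z ∷ []))) (upTo (length zs))) (χ (R (true , 1 , 0)))) ⟩
  χ (R (false , length P , length P)) + count (F′ (length (P ++ z ∷ []))) (upTo (length zs)) + χ (R (true , 1 , 0))
    ≡⟨ cong (_+ χ (R (true , 1 , 0))) (sym (trans (count-upTo-suc (F′ (length P)) (length zs)) shifted)) ⟩
  count (F′ (length P)) (upTo (suc (length zs))) + χ (R (true , 1 , 0)) ∎
  where
  open ≡-Reasoning
  F′ : ℕ → ℕ → Bool
  F′ o j = R (false , o + j , o + j)
  reassoc : (y ∷ P) ++ z ∷ zs ≡ (y ∷ P ++ z ∷ []) ++ zs
  reassoc = sym (++-assoc (y ∷ P) (z ∷ []) zs)
  regroup : map ((y ∷ P) ++_) (map (z ∷_) (insertions N zs)) ≡ map ((y ∷ P ++ z ∷ []) ++_) (insertions N zs)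
  regroup = trans (sym (map-∘ (insertions N zs))) (map-cong (λ τ → sym (++-assoc (y ∷ P) (z ∷ []) τ)) (insertions N zs))
  o+suc : ∀ j → length P + suc j ≡ length (P ++ z ∷ []) + j
  o+suc j = sym (trans (cong (_+ j) (length-++ P)) (+-assoc (length P) 1 j))
  shifted : χ (F′ (length P) 0) + count (F′ (length P) ∘ suc) (upTo (length zs)) ≡
            χ (R (false , length P , length P)) + count (F′ (length (P ++ z ∷ []))) (upTo (length zs))
  shifted = cong₂ _+_ (cong (λ o → χ (R (false , o , o))) (+-identityʳ (length P)))
                      (count-cong (upTo (length zs)) (λ j → cong (λ o → R (false , o , o)) (o+suc j)))

count-oneAscent-insertions-twoRuns-profile : ∀ N a A b B (R : Profile → Bool) → Decreasing (a ∷ A) → Decreasing (b ∷ B) →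
  lastOr a A < b → All (_< N) ((a ∷ A) ++ b ∷ B) →
  count (λ τ → oneAscent τ ∧ R (profile τ)) (insertions N ((a ∷ A) ++ b ∷ B)) ≡
    χ (R (shiftFront (profile ((a ∷ A) ++ b ∷ B)))) + χ (R (shiftMiddle (profile ((a ∷ A) ++ b ∷ B))))
count-oneAscent-insertions-twoRuns-profile N a A b B R decA decB ascent σ<N =
  trans (count-oneAscent-insertions-twoRuns N a A b B (R ∘ profile) decA decB ascent σ<N)
        (cong₂ (λ p q → χ (R p) + χ (R q)) (profile-front N a A b B decA decB ascent σ<N)
                                           (profile-middle N a A b B decA decB ascent σ<N))

decreasingContribution : ℕ → (Profile → Bool) → ℕ
decreasingContribution k R = count (λ j → R (false , j , j)) (upTo k) + χ (R (true , 1 , 0))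

count-oneAscent-insertions-Decreasing-profile : ∀ N σ (R : Profile → Bool) → σ ≢ [] → Decreasing σ → All (_< N) σ →
  count (λ τ → oneAscent τ ∧ R (profile τ)) (insertions N σ) ≡ decreasingContribution (length σ ∸ 1) R
count-oneAscent-insertions-Decreasing-profile N [] R σ≢[] _ _ = ⊥-elim (σ≢[] refl)
count-oneAscent-insertions-Decreasing-profile N (y ∷ ys) R _ dec σ<N =
  trans (count-oneAscent-insertions-Decreasing N y ys (R ∘ profile) dec σ<N)
        (count-profile-insertions-Decreasing N y [] ys R dec σ<N)

count-oneAscent-insertions-profile : ∀ k (R : Profile → Bool) {σ} → PermOf (suc k) σ →
  count (λ τ → oneAscent τ ∧ R (profile τ)) (insertions (suc (suc k)) σ) ≡
    decreasingContribution k R * χ (ascentFree σ) +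
    (χ (oneAscent σ ∧ R (shiftFront (profile σ))) + χ (oneAscent σ ∧ R (shiftMiddle (profile σ))))
count-oneAscent-insertions-profile k R {σ} σ-perm with asc σ in asc≡
... | zero = begin
  count (λ τ → oneAscent τ ∧ R (profile τ)) (insertions (suc (suc k)) σ)
    ≡⟨ count-oneAscent-insertions-Decreasing-profile (suc (suc k)) σ R σ≢[] (asc≡0⇒Decreasing (unique σ-perm) asc≡) (PermOf⇒All< σ-perm) ⟩
  decreasingContribution (length σ ∸ 1) R
    ≡⟨ cong (λ L → decreasingContribution (L ∸ 1) R) (length≡ σ-perm) ⟩
  decreasingContribution k R
    ≡⟨ sym (trans (+-identityʳ _) (*-identityʳ _)) ⟩
  decreasingContribution k R * 1 + 0 ∎
  where
  open ≡-Reasoning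
  σ≢[] : σ ≢ []
  σ≢[] refl = 0≢1+n (length≡ σ-perm)
... | suc (suc _) = trans
  (count-insertions≡0 asc asc-insert-max _ (λ τ → ≡ᵇ-∧-false _) (PermOf⇒All< σ-perm) (subst (1 <_) (sym asc≡) (s≤s (s≤s z≤n))))
  (sym (trans (+-identityʳ _) (*-zeroʳ (decreasingContribution k R))))
... | suc zero with asc≡1⇒TwoRuns σ (unique σ-perm) asc≡
...   | twoRuns a A b B refl decA decB ascent =
  trans (count-oneAscent-insertions-twoRuns-profile (suc (suc k)) a A b B R decA decB ascent (PermOf⇒All< σ-perm))
        (cong (_+ (χ (R (shiftFront p)) + χ (R (shiftMiddle p)))) (sym (*-zeroʳ (decreasingContribution k R))))
  where
  p : Profile
  p = profile ((a ∷ A) ++ b ∷ B)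

countProfile : ℕ → (Profile → Bool) → ℕ
countProfile n R = count (λ τ → oneAscent τ ∧ R (profile τ)) (perms n)

countProfile-suc : ∀ k R → countProfile (suc (suc k)) R ≡
  decreasingContribution k R + (countProfile (suc k) (R ∘ shiftFront) + countProfile (suc k) (R ∘ shiftMiddle))
countProfile-suc k R =
  trans (count-perms-suc (suc k) (λ τ → oneAscent τ ∧ R (profile τ)) ascentFree (decreasingContribution k R) _
                         (count-ascentFree-perms (suc k)) (count-oneAscent-insertions-profile k R))
        (cong (decreasingContribution k R +_) (sum-map-+ (λ σ → χ (oneAscent σ ∧ R (shiftFront (profile σ))))
                                                         (λ σ → χ (oneAscent σ ∧ R (shiftMiddle (profile σ)))) (perms (suc k))))

lowerAux higherAux higherWeight : ℕ → Profile → Bool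
lowerAux z (e , a , _) = e ∧ (a ≡ᵇ z)
higherAux z (e , a , _) = not e ∧ (a ≡ᵇ z)
higherWeight v (e , _ , w) = not e ∧ (w ≡ᵇ v)

countProfile-cong : ∀ n {R R′ : Profile → Bool} → (∀ p → R p ≡ R′ p) → countProfile n R ≡ countProfile n R′
countProfile-cong n R≗R′ = count-cong (perms n) (λ τ → cong (oneAscent τ ∧_) (R≗R′ (profile τ)))

countProfile-false : ∀ n → countProfile n (λ _ → false) ≡ 0
countProfile-false n = count≡0 (perms n) (λ {τ} _ → ∧-zeroʳ (oneAscent τ))

C-positive : ∀ n k → k ≤ n → 1 ≤ n C k
C-positive n zero _ = ≤-refl
C-positive (suc n) (suc k) (s≤s k≤n) =
  ≤-trans (C-positive n k k≤n) (≤-trans (m≤m+n (n C k) (n C suc k)) (≤-reflexive (nCk+nC[k+1]≡[n+1]C[k+1] n k)))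

lowerAux-shiftFront : ∀ z p → lowerAux z (shiftFront p) ≡ lowerAux z p
lowerAux-shiftFront z (true , _) = refl
lowerAux-shiftFront z (false , _) = refl

lowerAux-shiftMiddle-zero : ∀ p → lowerAux 0 (shiftMiddle p) ≡ false
lowerAux-shiftMiddle-zero (true , _) = refl
lowerAux-shiftMiddle-zero (false , _) = refl

lowerAux-shiftMiddle-suc : ∀ z p → lowerAux (suc z) (shiftMiddle p) ≡ lowerAux z p
lowerAux-shiftMiddle-suc z (true , _) = refl
lowerAux-shiftMiddle-suc z (false , _) = refl

higherAux-shiftFront-zero : ∀ p → higherAux 0 (shiftFront p) ≡ false
higherAux-shiftFront-zero (true , _) = refl
higherAux-shiftFront-zero (false , _) = refl

higherAux-shiftFront-suc : ∀ z p → higherAux (suc z) (shiftFront p) ≡ higherAux z p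
higherAux-shiftFront-suc z (true , _) = refl
higherAux-shiftFront-suc z (false , _) = refl

higherAux-shiftMiddle : ∀ z p → higherAux z (shiftMiddle p) ≡ higherAux z p
higherAux-shiftMiddle z (true , _) = refl
higherAux-shiftMiddle z (false , _) = refl

higherWeight-shiftFront : ∀ v p → higherWeight v (shiftFront p) ≡ higherWeight v p
higherWeight-shiftFront v (true , _) = refl
higherWeight-shiftFront v (false , _) = refl

higherWeight-shiftMiddle : ∀ v p → higherWeight v (shiftMiddle p) ≡ higherAux v p
higherWeight-shiftMiddle v (true , _) = refl
higherWeight-shiftMiddle v (false , _) = refl

pascal-∸1 : ∀ k z → χ (suc z <ᵇ k) + ((k C suc z ∸ 1) + (k C suc (suc z) ∸ 1)) ≡ suc k C suc (suc z) ∸ 1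
pascal-∸1 k z with suc z <? k
... | yes z<k = begin
  χ (suc z <ᵇ k) + ((X ∸ 1) + (Y ∸ 1))  ≡⟨ cong (λ b → χ b + ((X ∸ 1) + (Y ∸ 1))) (<⇒<ᵇ≡true z<k) ⟩
  1 + ((X ∸ 1) + (Y ∸ 1))             ≡⟨ 1+[x∸1]+[y∸1] (C-positive k (suc z) (<⇒≤ z<k)) (C-positive k (suc (suc z)) z<k) ⟩
  (X + Y) ∸ 1                         ≡⟨ cong (_∸ 1) (nCk+nC[k+1]≡[n+1]C[k+1] k (suc z)) ⟩
  suc k C suc (suc z) ∸ 1             ∎
  where
  open ≡-Reasoning
  X Y : ℕ
  X = k C suc z
  Y = k C suc (suc z)
  1+[x∸1]+[y∸1] : ∀ {x y} → 1 ≤ x → 1 ≤ y → 1 + ((x ∸ 1) + (y ∸ 1)) ≡ (x + y) ∸ 1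
  1+[x∸1]+[y∸1] {suc x} {suc y} _ _ = sym (+-suc x y)
... | no z≮k = begin
  χ (suc z <ᵇ k) + ((X ∸ 1) + (Y ∸ 1))  ≡⟨ cong₂ (λ b y → χ b + ((X ∸ 1) + (y ∸ 1))) (≥⇒<ᵇ≡false (≮⇒≥ z≮k)) Y≡0 ⟩
  (X ∸ 1) + 0                         ≡⟨ +-identityʳ (X ∸ 1) ⟩
  X ∸ 1                               ≡⟨ cong (_∸ 1) (sym (+-identityʳ X)) ⟩
  (X + 0) ∸ 1                         ≡⟨ cong (λ y → (X + y) ∸ 1) (sym Y≡0) ⟩
  (X + Y) ∸ 1                         ≡⟨ cong (_∸ 1) (nCk+nC[k+1]≡[n+1]C[k+1] k (suc z)) ⟩
  suc k C suc (suc z) ∸ 1             ∎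
  where
  open ≡-Reasoning
  X Y : ℕ
  X = k C suc z
  Y = k C suc (suc z)
  Y≡0 : Y ≡ 0
  Y≡0 = k>n⇒nCk≡0 (s≤s (≮⇒≥ z≮k))

pascal-χ : ∀ k v → χ (v <ᵇ k) + (k C suc (suc v) + (k C suc v ∸ 1)) ≡ suc k C suc (suc v)
pascal-χ k v with v <? k
... | yes v<k = begin
  χ (v <ᵇ k) + (Y + (X ∸ 1))  ≡⟨ cong (λ b → χ b + (Y + (X ∸ 1))) (<⇒<ᵇ≡true v<k) ⟩
  1 + (Y + (X ∸ 1))           ≡⟨ 1+[y+[x∸1]] (C-positive k (suc v) v<k) ⟩
  X + Y                       ≡⟨ nCk+nC[k+1]≡[n+1]C[k+1] k (suc v) ⟩
  suc k C suc (suc v)         ∎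
  where
  open ≡-Reasoning
  X Y : ℕ
  X = k C suc v
  Y = k C suc (suc v)
  1+[y+[x∸1]] : ∀ {x} → 1 ≤ x → 1 + (Y + (x ∸ 1)) ≡ x + Y
  1+[y+[x∸1]] {suc x} _ = cong suc (+-comm Y x)
... | no v≮k = begin
  χ (v <ᵇ k) + (Y + (X ∸ 1))  ≡⟨ cong₂ (λ b x → χ b + (Y + (x ∸ 1))) (≥⇒<ᵇ≡false (≮⇒≥ v≮k)) X≡0 ⟩
  Y + 0                       ≡⟨ +-identityʳ Y ⟩
  Y                           ≡⟨ cong (_+ Y) (sym X≡0) ⟩
  X + Y                       ≡⟨ nCk+nC[k+1]≡[n+1]C[k+1] k (suc v) ⟩
  suc k C suc (suc v)         ∎
  where
  open ≡-Reasoning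
  X Y : ℕ
  X = k C suc v
  Y = k C suc (suc v)
  X≡0 : X ≡ 0
  X≡0 = k>n⇒nCk≡0 (s≤s (≮⇒≥ v≮k))

countProfile-lowerAux-zero : ∀ n → countProfile n (lowerAux 0) ≡ 0
countProfile-lowerAux-zero zero = refl
countProfile-lowerAux-zero (suc zero) = refl
countProfile-lowerAux-zero (suc (suc k)) = begin
  countProfile (suc (suc k)) (lowerAux 0)
    ≡⟨ countProfile-suc k (lowerAux 0) ⟩
  decreasingContribution k (lowerAux 0) + (countProfile (suc k) (lowerAux 0 ∘ shiftFront) + countProfile (suc k) (lowerAux 0 ∘ shiftMiddle))
    ≡⟨ cong₂ (λ a b → decreasingContribution k (lowerAux 0) + (a + b))
             (trans (countProfile-cong (suc k) (lowerAux-shiftFront 0)) (countProfile-lowerAux-zero (suc k)))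
             (trans (countProfile-cong (suc k) lowerAux-shiftMiddle-zero) (countProfile-false (suc k))) ⟩
  decreasingContribution k (lowerAux 0) + 0
    ≡⟨ +-identityʳ _ ⟩
  count (λ _ → false) (upTo k) + 0
    ≡⟨ cong (_+ 0) (count≡0 (upTo k) (λ _ → refl)) ⟩
  0 ∎
  where open ≡-Reasoning

countProfile-lowerAux : ∀ k z → countProfile (suc k) (lowerAux (suc z)) ≡ k C suc z
countProfile-lowerAux zero z = refl
countProfile-lowerAux (suc k) z = begin
  countProfile (suc (suc k)) (lowerAux (suc z))
    ≡⟨ countProfile-suc k (lowerAux (suc z)) ⟩
  decreasingContribution k (lowerAux (suc z)) + (countProfile (suc k) (lowerAux (suc z) ∘ shiftFront) + countProfile (suc k) (lowerAux (suc z) ∘ shiftMiddle))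
    ≡⟨ cong₂ (λ a b → decreasingContribution k (lowerAux (suc z)) + (a + b))
             (trans (countProfile-cong (suc k) (lowerAux-shiftFront (suc z))) (countProfile-lowerAux k z))
             (countProfile-cong (suc k) (lowerAux-shiftMiddle-suc z)) ⟩
  decreasingContribution k (lowerAux (suc z)) + (k C suc z + countProfile (suc k) (lowerAux z))
    ≡⟨ cong (_+ (k C suc z + countProfile (suc k) (lowerAux z))) (cong (_+ χ (0 ≡ᵇ z)) (count≡0 (upTo k) (λ _ → refl))) ⟩
  χ (0 ≡ᵇ z) + (k C suc z + countProfile (suc k) (lowerAux z))
    ≡⟨ pascal z ⟩
  suc k C suc z ∎
  where
  open ≡-Reasoning
  pascal : ∀ z → χ (0 ≡ᵇ z) + (k C suc z + countProfile (suc k) (lowerAux z)) ≡ suc k C suc z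
  pascal zero rewrite countProfile-lowerAux-zero (suc k) | nC1≡n k | nC1≡n (suc k) = cong suc (+-identityʳ k)
  pascal (suc z) rewrite countProfile-lowerAux k z = trans (+-comm (k C suc (suc z)) (k C suc z)) (nCk+nC[k+1]≡[n+1]C[k+1] k (suc z))

countProfile-higherAux : ∀ k z → countProfile (suc k) (higherAux z) ≡ k C suc z ∸ 1
countProfile-higherAux zero z = refl
countProfile-higherAux (suc k) z = begin
  countProfile (suc (suc k)) (higherAux z)
    ≡⟨ countProfile-suc k (higherAux z) ⟩
  decreasingContribution k (higherAux z) + (countProfile (suc k) (higherAux z ∘ shiftFront) + countProfile (suc k) (higherAux z ∘ shiftMiddle))
    ≡⟨ cong₂ _+_ (trans (+-identityʳ _) (count-≡ᵇ-upTo z k))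
                 (cong₂ _+_ (front z) (trans (countProfile-cong (suc k) (higherAux-shiftMiddle z)) (countProfile-higherAux k z))) ⟩
  χ (z <ᵇ k) + (pred? z + (k C suc z ∸ 1))
    ≡⟨ pascal z ⟩
  suc k C suc z ∸ 1 ∎
  where
  open ≡-Reasoning
  pred? : ℕ → ℕ
  pred? zero = 0
  pred? (suc z) = k C suc z ∸ 1
  front : ∀ z → countProfile (suc k) (higherAux z ∘ shiftFront) ≡ pred? z
  front zero = trans (countProfile-cong (suc k) higherAux-shiftFront-zero) (countProfile-false (suc k))
  front (suc z) = trans (countProfile-cong (suc k) (higherAux-shiftFront-suc z)) (countProfile-higherAux k z)
  pascal : ∀ z → χ (z <ᵇ k) + (pred? z + (k C suc z ∸ 1)) ≡ suc k C suc z ∸ 1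
  pascal zero rewrite nC1≡n k | nC1≡n (suc k) = χ[0<n]+[n∸1]≡n k
    where
    χ[0<n]+[n∸1]≡n : ∀ n → χ (0 <ᵇ n) + (0 + (n ∸ 1)) ≡ n
    χ[0<n]+[n∸1]≡n zero = refl
    χ[0<n]+[n∸1]≡n (suc n) = refl
  pascal (suc z) = pascal-∸1 k z

countProfile-higherWeight : ∀ k v → countProfile (suc k) (higherWeight v) ≡ k C suc (suc v)
countProfile-higherWeight zero v = refl
countProfile-higherWeight (suc k) v = begin
  countProfile (suc (suc k)) (higherWeight v)
    ≡⟨ countProfile-suc k (higherWeight v) ⟩
  decreasingContribution k (higherWeight v) + (countProfile (suc k) (higherWeight v ∘ shiftFront) + countProfile (suc k) (higherWeight v ∘ shiftMiddle))
    ≡⟨ cong₂ _+_ (trans (+-identityʳ _) (count-≡ᵇ-upTo v k))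
                 (cong₂ _+_ (trans (countProfile-cong (suc k) (higherWeight-shiftFront v)) (countProfile-higherWeight k v))
                            (trans (countProfile-cong (suc k) (higherWeight-shiftMiddle v)) (countProfile-higherAux k v))) ⟩
  χ (v <ᵇ k) + (k C suc (suc v) + (k C suc v ∸ 1))
    ≡⟨ pascal-χ k v ⟩
  suc k C suc (suc v) ∎
  where
  open ≡-Reasoning

-- When A ends below B the weight is auxStat - 1 with auxStat = |B| ≥ 1, whence suc m.
weight-split : ∀ m τ → Unique τ →
  χ (oneAscent τ ∧ (oneAscentWeight (descentRun τ) ≡ᵇ m)) ≡ χ (oneAscent τ ∧ lowerAux (suc m) (profile τ)) + χ (oneAscent τ ∧ higherWeight m (profile τ))
weight-split m τ u with asc τ ≡ᵇ 1 in asc≡ᵇ1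
... | false = refl
... | true with asc≡1⇒TwoRuns τ u (≡ᵇ≡true⇒≡ asc≡ᵇ1)
...   | twoRuns a A b B refl decA _ ascent rewrite descentRun-twoRuns a A b B decA ascent with lastOr a A <ᵇ lastOr b B
...     | true = sym (+-identityʳ _)
...     | false = refl

count-oneAscent-weight : ∀ k m → count (λ τ → oneAscent τ ∧ (oneAscentWeight (descentRun τ) ≡ᵇ m)) (perms (suc k)) ≡ suc k C suc (suc m)
count-oneAscent-weight k m = begin
  count (λ τ → oneAscent τ ∧ (oneAscentWeight (descentRun τ) ≡ᵇ m)) (perms (suc k))
    ≡⟨ sum-map-cong-∈ (perms (suc k)) (λ {τ} τ∈ → weight-split m τ (unique (perms-PermOf (suc k) τ∈))) ⟩
  sum (map (λ τ → χ (oneAscent τ ∧ lowerAux (suc m) (profile τ)) + χ (oneAscent τ ∧ higherWeight m (profile τ))) (perms (suc k)))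
    ≡⟨ sum-map-+ (λ τ → χ (oneAscent τ ∧ lowerAux (suc m) (profile τ))) (λ τ → χ (oneAscent τ ∧ higherWeight m (profile τ))) (perms (suc k)) ⟩
  countProfile (suc k) (lowerAux (suc m)) + countProfile (suc k) (higherWeight m)
    ≡⟨ cong₂ _+_ (countProfile-lowerAux k m) (countProfile-higherWeight k m) ⟩
  k C suc m + k C suc (suc m)
    ≡⟨ nCk+nC[k+1]≡[n+1]C[k+1] k (suc m) ⟩
  suc k C suc (suc m) ∎
  where open ≡-Reasoning

n≤n*n : ∀ n → n ≤ n * n
n≤n*n zero = z≤n
n≤n*n (suc n) = m≤m*n (suc n) (suc n)

w-oneDescent : ∀ {n π} → PermOf n π → des π ≡ 1 → w π ≡ leadingMinima π
w-oneDescent {π = π} π-perm des≡1 =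
  trans (cong (wF (suc (length π * length π))) (sym (st-PermOf π-perm)))
        (wF-st-oneDescent _ π (unique π-perm) des≡1 (s≤s (≤-trans (leadingMinima-≤length π) (n≤n*n (length π)))))

w-oneAscent : ∀ {n π} → PermOf n π → asc π ≡ 1 → w π ≡ oneAscentWeight (descentRun π)
w-oneAscent {π = π} π-perm asc≡1 =
  trans (cong (wF (suc (length π * length π))) (sym (st-PermOf π-perm)))
        (wF-st-oneAscent (length π * length π) π (unique π-perm) asc≡1)

coeffE-oneDescent : ∀ n m → coeffE n 1 m ≡ 2 ^ (n ∸ 1 ∸ m) ∸ 1
coeffE-oneDescent n m = begin
  coeffE n 1 m                                               ≡⟨ length-filter≡count _ (perms n) ⟩
  count (λ π → (des π ≡ᵇ 1) ∧ (w π ≡ᵇ m)) (perms n)          ≡⟨ count-cong-∈ (perms n) (by-weight ∘ perms-PermOf n) ⟩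
  count (oneDescent (_≡ᵇ m)) (perms n)                       ≡⟨ count-oneDescent-perms n m ⟩
  2 ^ (n ∸ 1 ∸ m) ∸ 1                                        ∎
  where
  open ≡-Reasoning
  by-weight : ∀ {π} → PermOf n π → ((des π ≡ᵇ 1) ∧ (w π ≡ᵇ m)) ≡ oneDescent (_≡ᵇ m) π
  by-weight {π} π-perm with des π ≡ᵇ 1 in des≡ᵇ1
  ... | true rewrite w-oneDescent π-perm (≡ᵇ≡true⇒≡ des≡ᵇ1) = refl
  ... | false = refl

≡ᵇ-complement : ∀ d a k → d + a ≡ suc k → (d ≡ᵇ k) ≡ (a ≡ᵇ 1)
≡ᵇ-complement d a k d+a≡ with a ≟ 1
... | yes refl rewrite ≡⇒≡ᵇ≡true (suc-injective (trans (+-comm 1 d) d+a≡)) = refl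
... | no a≢1 rewrite ≢⇒≡ᵇ≡false a≢1 = ≢⇒≡ᵇ≡false {d} {k} λ { refl → a≢1 (+-cancelˡ-≡ d a 1 (trans d+a≡ (+-comm 1 d))) }

coeffE-oneAscent : ∀ k m → coeffE (suc (suc k)) k m ≡ suc (suc k) C suc (suc m)
coeffE-oneAscent k m = begin
  coeffE (suc (suc k)) k m
    ≡⟨ length-filter≡count _ (perms (suc (suc k))) ⟩
  count (λ π → (des π ≡ᵇ k) ∧ (w π ≡ᵇ m)) (perms (suc (suc k)))
    ≡⟨ count-cong-∈ (perms (suc (suc k))) (by-weight ∘ perms-PermOf (suc (suc k))) ⟩
  count (λ π → oneAscent π ∧ (oneAscentWeight (descentRun π) ≡ᵇ m)) (perms (suc (suc k)))
    ≡⟨ count-oneAscent-weight (suc k) m ⟩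
  suc (suc k) C suc (suc m) ∎
  where
  open ≡-Reasoning
  by-weight : ∀ {π} → PermOf (suc (suc k)) π → ((des π ≡ᵇ k) ∧ (w π ≡ᵇ m)) ≡ (oneAscent π ∧ (oneAscentWeight (descentRun π) ≡ᵇ m))
  by-weight {π} π-perm =
    trans (cong (_∧ (w π ≡ᵇ m)) (≡ᵇ-complement (des π) (asc π) k (trans (des+asc≡length∸1 (unique π-perm)) (cong (_∸ 1) (length≡ π-perm)))))
          (by-ascent π-perm)
    where
    by-ascent : ∀ {τ} → PermOf (suc (suc k)) τ → (oneAscent τ ∧ (w τ ≡ᵇ m)) ≡ (oneAscent τ ∧ (oneAscentWeight (descentRun τ) ≡ᵇ m))
    by-ascent {τ} τ-perm with asc τ ≡ᵇ 1 in asc≡ᵇ1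
    ... | true rewrite w-oneAscent τ-perm (≡ᵇ≡true⇒≡ asc≡ᵇ1) = refl
    ... | false = refl

sum-coefficient : ∀ k (c : ℕ → ℕ) m →
  sum (applyUpTo (λ j → if (k ∸ j) ≡ᵇ m then c j else 0) (suc k)) ≡ (if m ≤ᵇ k then c (k ∸ m) else 0)
sum-coefficient zero c zero = +-identityʳ (c 0)
sum-coefficient zero c (suc m) = refl
sum-coefficient (suc k) c m = trans (cong ((if suc k ≡ᵇ m then c 0 else 0) +_) (sum-coefficient k (c ∘ suc) m)) (by-cases m)
  where
  by-cases : ∀ m → (if suc k ≡ᵇ m then c 0 else 0) + (if m ≤ᵇ k then c (suc (k ∸ m)) else 0) ≡ (if m ≤ᵇ suc k then c (suc k ∸ m) else 0)
  by-cases m with <-cmp m (suc k)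
  ... | tri< m<1+k _ _ rewrite ≢⇒≡ᵇ≡false {suc k} {m} (>⇒≢ m<1+k) | ≤⇒≤ᵇ≡true (≤-pred m<1+k) | ≤⇒≤ᵇ≡true {m} {suc k} (<⇒≤ m<1+k)
                             | +-∸-assoc 1 (≤-pred m<1+k) = refl
  ... | tri≈ _ refl _ rewrite ≡⇒≡ᵇ≡true {suc k} refl | >⇒≤ᵇ≡false {suc k} {k} ≤-refl | ≤⇒≤ᵇ≡true {suc k} {suc k} ≤-refl | n∸n≡0 k =
    +-identityʳ (c 0)
  ... | tri> _ _ m>1+k rewrite ≢⇒≡ᵇ≡false {suc k} {m} (<⇒≢ m>1+k) | >⇒≤ᵇ≡false {m} {k} (<-trans (n<1+n k) m>1+k)
                             | >⇒≤ᵇ≡false {m} {suc k} m>1+k = refl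

coeffQ-evaluate : ∀ k (c : ℕ → ℕ) m → coeffQ (suc (suc k)) c m ≡ (if m ≤ᵇ k then c (k ∸ m) else 0)
coeffQ-evaluate k c m = trans (cong sum (map-applyUpTo (λ j → j) (λ j → if (k ∸ j) ≡ᵇ m then c j else 0) (suc k))) (sum-coefficient k c m)

coeffQ-mersenne : ∀ k m → coeffQ (suc (suc k)) (λ j → 2 ^ (j + 1) ∸ 1) m ≡ 2 ^ (suc k ∸ m) ∸ 1
coeffQ-mersenne k m = trans (coeffQ-evaluate k _ m) (by-cases m)
  where
  by-cases : ∀ m → (if m ≤ᵇ k then 2 ^ (k ∸ m + 1) ∸ 1 else 0) ≡ 2 ^ (suc k ∸ m) ∸ 1
  by-cases m with m ≤? k
  ... | yes m≤k rewrite ≤⇒≤ᵇ≡true m≤k | +-∸-assoc 1 m≤k | +-comm (k ∸ m) 1 = refl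
  ... | no m≰k rewrite >⇒≤ᵇ≡false (≰⇒> m≰k) | m≤n⇒m∸n≡0 (≰⇒> m≰k) = refl

coeffQ-binomial : ∀ k m → coeffQ (suc (suc k)) (suc (suc k) C_) m ≡ suc (suc k) C suc (suc m)
coeffQ-binomial k m = trans (coeffQ-evaluate k _ m) by-cases
  where
  by-cases : (if m ≤ᵇ k then suc (suc k) C (k ∸ m) else 0) ≡ suc (suc k) C suc (suc m)
  by-cases with m ≤? k
  ... | yes m≤k rewrite ≤⇒≤ᵇ≡true m≤k =
    trans (nCk≡nC[n∸k] (≤-trans (m∸n≤m k m) (≤-trans (n≤1+n k) (n≤1+n (suc k))))) (cong (suc (suc k) C_) complement)
    where
    complement : suc (suc k) ∸ (k ∸ m) ≡ suc (suc m)
    complement = begin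
      suc (suc k) ∸ (k ∸ m)                ≡⟨ cong (λ j → suc (suc j) ∸ (k ∸ m)) (sym (m∸n+n≡m m≤k)) ⟩
      suc (suc (k ∸ m + m)) ∸ (k ∸ m)      ≡⟨ cong (_∸ (k ∸ m)) (sym (trans (+-suc (k ∸ m) (suc m)) (cong suc (+-suc (k ∸ m) m)))) ⟩
      ((k ∸ m) + suc (suc m)) ∸ (k ∸ m)    ≡⟨ m+n∸m≡n (k ∸ m) (suc (suc m)) ⟩
      suc (suc m)                          ∎
      where open ≡-Reasoning
  ... | no m≰k rewrite >⇒≤ᵇ≡false (≰⇒> m≰k) = sym (k>n⇒nCk≡0 (s≤s (s≤s (≰⇒> m≰k))))

corollary6p5 : (n : ℕ) → 2 ≤ n → (m : ℕ) →
    (coeffE n 1 m ≡ coeffQ n (λ j → 2 ^ (j + 1) ∸ 1) m)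
    × (coeffE n (n ∸ 2) m ≡ coeffQ n (λ j → n C j) m)
corollary6p5 (suc (suc k)) _ m =
  trans (coeffE-oneDescent (suc (suc k)) m) (sym (coeffQ-mersenne k m)) ,
  trans (coeffE-oneAscent k m) (sym (coeffQ-binomial k m))
corollary6p5 (suc zero) (s≤s ()) m
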